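{- Let $M$ be a 3-connected matroid. Then $M$ is $U_{1,4}$-connected if and only if either $M \cong U_{2,n}$ for some $n \geq 5$, or $M$ has rank at least three and corank at least three.
   Context: A matroid $M$ with $|E(M)| \geq 2$ is $N$-connected if for every pair of distinct elements $e,f \in E(M)$ there is a minor of $M$ isomorphic to $N$ whose ground set contains $\{e,f\}$. -}

module Defs where

open import Data.Nat using (ℕ; _≤_; _<_; _+_; _⊓_)
open import Data.Fin using (Fin; _≟_)
open import Data.Fin.Properties using (any?)
open import Data.Fin.Subset using (Subset; _∈_; _∉_; _⊆_; _∪_; _∩_; ∁; ∣_∣; ⊤)
open import Data.Fin.Subset.Properties using (_∈?_)
open import Data.Vec using (tabulate)
open import Data.Product using (Σ; _×_; ∃; ∃-syntax; _,_)
open import Relation.Nullary.Decidable using (⌊_⌋; _×-dec_)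
open import Relation.Binary.PropositionalEquality using (_≡_; _≢_)
open import Function.Definitions using (Injective; Bijective)
open import Function.Bundles using (_⇔_)

record Matroid (n : ℕ) : Set where
  field
    rk        : Subset n → ℕ
    rk-bound  : ∀ X → rk X ≤ ∣ X ∣
    rk-mono   : ∀ {X Y} → X ⊆ Y → rk X ≤ rk Y
    rk-submod : ∀ X Y → rk (X ∪ Y) + rk (X ∩ Y) ≤ rk X + rk Y
open Matroid public

rank : ∀ {n} → Matroid n → ℕ
rank M = rk M ⊤

corank : ∀ {n} → Matroid n → ℕ
corank {n} M = n Data.Nat.∸ rk M ⊤

U-rk : (r m : ℕ) → Subset m → ℕ
U-rk r m X = r ⊓ ∣ X ∣

image : ∀ {m n} → (Fin m → Fin n) → Subset m → Subset n
image {m} φ X = tabulate (λ j → ⌊ any? (λ i → (φ i ≟ j) ×-dec (i ∈? X)) ⌋)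

_≅_ : ∀ {m n} → Matroid m → (Subset n → ℕ) → Set
_≅_ {m} {n} M rN = Σ (Fin m → Fin n) λ φ → Bijective _≡_ _≡_ φ × (∀ X → rk M X ≡ rN (image φ X))

-- M has a minor M / C \ D (C, D disjoint) isomorphic to the matroid N
-- (rank function rN on Fin k) whose ground set contains e and f.
-- The isomorphism is ψ : Fin k → E(M) - (C ∪ D) (injective, onto E - (C ∪ D)),
-- and the rank function of M / C \ D is X ↦ r(X ∪ C) - r(C).
HasMinorUsing : ∀ {n} → Matroid n → (k : ℕ) → (Subset k → ℕ) → Fin n → Fin n → Set
HasMinorUsing {n} M k rN e f =
  Σ (Subset n) λ C → Σ (Subset n) λ D → Σ (Fin k → Fin n) λ ψ →
    (∀ x → x ∈ C → x ∉ D)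
  × Injective _≡_ _≡_ ψ
  × (∀ x → (x ∉ C × x ∉ D) ⇔ (∃[ i ] ψ i ≡ x))
  × (∀ X → rN X + rk M C ≡ rk M (image ψ X ∪ C))
  × (e ∉ C × e ∉ D) × (f ∉ C × f ∉ D)

NConnected : ∀ {n} → Matroid n → (k : ℕ) → (Subset k → ℕ) → Set
NConnected {n} M k rN = 2 ≤ n × (∀ e f → e ≢ f → HasMinorUsing M k rN e f)

ThreeConnected : ∀ {n} → Matroid n → Set
ThreeConnected M = ∀ (X : Subset _) (j : ℕ) → j < 3 → j ≤ ∣ X ∣ → j ≤ ∣ ∁ X ∣ →
  rk M ⊤ + j ≤ rk M X + rk M (∁ X)

-- The forward direction is counting: a U_{1,4}-minor M / C \ D gives r(M) ≤ |C| + |D| + 1 = n − 3,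
-- three-connectivity gives r(M) ≥ 2, and a three-connected matroid of rank two has neither loops
-- nor parallel pairs, so it is U_{2,n}.
--
-- The converse only uses r(M) ≤ n − 3. Fix e ≠ f and work with the rank function of M*. Let T
-- consist of e, f and the elements outside the closure of {e, f} in M*. As E − T lies in that
-- closure, three-connectivity makes T spanning in M* and rules out a separation of M* | T with e
-- and f on different sides. Induction on |T|, deleting or contracting a third element, then gives
-- C ⊆ T − {e, f} with e and f parallel in M* / C. For minimal C, every c ∈ C forms a triangle with
-- e and f in M* / (C − c), and |C| ≥ 2 since {e, f} spans no other element of T in M*. Dually,
-- M / (E − (C ∪ {e, f})) has rank one and no loops, so e, f and two elements of C form a U_{1,4}.

module Submission where

open import Defs
open import Data.Nat using (ℕ; _≤_)
open import Data.Product using (Σ; _×_)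
open import Data.Sum using (_⊎_)
open import Function.Bundles using (_⇔_)

open import Data.Nat using (zero; suc; _<_; _+_; _∸_; _⊓_; z≤n; s≤s; _≤?_)
import Data.Nat.Properties as ℕ
open import Data.Nat.Tactic.RingSolver using (solve-∀)
open import Algebra.Properties.CommutativeSemigroup ℕ.+-commutativeSemigroup using (interchange)
open import Data.Bool using (true; false)
open import Data.Empty using (⊥-elim)
open import Data.Fin using (Fin; zero; suc; _≟_; fromℕ<)
open import Data.Fin.Properties using (any?; suc-injective; 0≢1+n; injective⇒≤)
open import Data.Fin.Subset
open import Data.Fin.Subset.Properties
open import Data.Product using (∃; _,_; proj₁; proj₂)
open import Data.Sum using (inj₁; inj₂; [_,_]′)
open import Data.Vec using ([]; _∷_; tabulate; lookup)
import Data.Vec.Properties as Vec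
open import Data.Vec.Relation.Unary.All using ([]; _∷_)
open import Data.Vec.Relation.Unary.AllPairs using ([]; _∷_)
open import Data.Vec.Relation.Unary.Unique.Propositional using (Unique)
open import Data.Vec.Relation.Unary.Unique.Propositional.Properties using (lookup-injective)
open import Function.Base using (id; _∘′_; case_of_)
open import Function.Bundles using (mk⇔; Equivalence)
open import Function.Definitions using (Injective)
open import Relation.Binary.PropositionalEquality
open import Relation.Nullary using (¬_; Dec; yes; no; ¬?)
open import Relation.Nullary.Decidable using (⌊_⌋; _×-dec_)

-- Finite subsets

private variable
  n : ℕ
  x y : Fin n
  p q u : Subset n

∪⁺ˡ : x ∈ p → x ∈ p ∪ q
∪⁺ˡ x∈p = x∈p∪q⁺ (inj₁ x∈p)

∪⁺ʳ : x ∈ q → x ∈ p ∪ q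
∪⁺ʳ x∈q = x∈p∪q⁺ (inj₂ x∈q)

∪⁻ : x ∈ p ∪ q → x ∈ p ⊎ x ∈ q
∪⁻ {p = p} {q = q} = x∈p∪q⁻ p q

∩⁺ : x ∈ p → x ∈ q → x ∈ p ∩ q
∩⁺ x∈p x∈q = x∈p∩q⁺ (x∈p , x∈q)

∩⁻ˡ : x ∈ p ∩ q → x ∈ p
∩⁻ˡ {p = p} {q = q} = p∩q⊆p p q

∩⁻ʳ : x ∈ p ∩ q → x ∈ q
∩⁻ʳ {p = p} {q = q} = p∩q⊆q p q

∁⁺ : x ∉ p → x ∈ ∁ p
∁⁺ = x∉p⇒x∈∁p

∁⁻ : x ∈ ∁ p → x ∉ p
∁⁻ = x∈∁p⇒x∉p

∈⁅⁆⇒≡ : x ∈ ⁅ y ⁆ → x ≡ y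
∈⁅⁆⇒≡ {y = y} = x∈⁅y⁆⇒x≡y y

⁅⁆⊆ : x ∈ p → ⁅ x ⁆ ⊆ p
⁅⁆⊆ {p = p} x∈p y∈⁅x⁆ = subst (_∈ p) (sym (∈⁅⁆⇒≡ y∈⁅x⁆)) x∈p

∪-lub : p ⊆ u → q ⊆ u → p ∪ q ⊆ u
∪-lub p⊆u q⊆u z∈p∪q with ∪⁻ z∈p∪q
... | inj₁ z∈p = p⊆u z∈p
... | inj₂ z∈q = q⊆u z∈q

Disjoint : Subset n → Subset n → Set
Disjoint p q = ∀ x → x ∈ p → x ∉ q

∣p∪q∣+∣p∩q∣≡∣p∣+∣q∣ : ∀ (p q : Subset n) → ∣ p ∪ q ∣ + ∣ p ∩ q ∣ ≡ ∣ p ∣ + ∣ q ∣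
∣p∪q∣+∣p∩q∣≡∣p∣+∣q∣ []          []          = refl
∣p∪q∣+∣p∩q∣≡∣p∣+∣q∣ (true ∷ p)  (true ∷ q)  = cong suc (begin
  ∣ p ∪ q ∣ + suc ∣ p ∩ q ∣ ≡⟨ ℕ.+-suc ∣ p ∪ q ∣ ∣ p ∩ q ∣ ⟩
  suc (∣ p ∪ q ∣ + ∣ p ∩ q ∣) ≡⟨ cong suc (∣p∪q∣+∣p∩q∣≡∣p∣+∣q∣ p q) ⟩
  suc (∣ p ∣ + ∣ q ∣) ≡⟨ ℕ.+-suc ∣ p ∣ ∣ q ∣ ⟨
  ∣ p ∣ + suc ∣ q ∣ ∎)
  where open ≡-Reasoning
∣p∪q∣+∣p∩q∣≡∣p∣+∣q∣ (true ∷ p)  (false ∷ q) = cong suc (∣p∪q∣+∣p∩q∣≡∣p∣+∣q∣ p q)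
∣p∪q∣+∣p∩q∣≡∣p∣+∣q∣ (false ∷ p) (true ∷ q)  =
  trans (cong suc (∣p∪q∣+∣p∩q∣≡∣p∣+∣q∣ p q)) (sym (ℕ.+-suc ∣ p ∣ ∣ q ∣))
∣p∪q∣+∣p∩q∣≡∣p∣+∣q∣ (false ∷ p) (false ∷ q) = ∣p∪q∣+∣p∩q∣≡∣p∣+∣q∣ p q

∣p∣+∣∁p∣≡n : ∀ (p : Subset n) → ∣ p ∣ + ∣ ∁ p ∣ ≡ n
∣p∣+∣∁p∣≡n p = trans (cong (∣ p ∣ +_) (∣∁p∣≡n∸∣p∣ p)) (ℕ.m+[n∸m]≡n (∣p∣≤n p))

Disjoint⇒∣p∪q∣≡∣p∣+∣q∣ : ∀ (p q : Subset n) → Disjoint p q → ∣ p ∪ q ∣ ≡ ∣ p ∣ + ∣ q ∣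
Disjoint⇒∣p∪q∣≡∣p∣+∣q∣ {n} p q p∩q=∅ = begin
  ∣ p ∪ q ∣                 ≡⟨ ℕ.+-identityʳ _ ⟨
  ∣ p ∪ q ∣ + 0             ≡⟨ cong (∣ p ∪ q ∣ +_) (∣⊥∣≡0 n) ⟨
  ∣ p ∪ q ∣ + ∣ ⊥ {n} ∣     ≡⟨ cong (λ r → ∣ p ∪ q ∣ + ∣ r ∣) p∩q≡⊥ ⟨
  ∣ p ∪ q ∣ + ∣ p ∩ q ∣     ≡⟨ ∣p∪q∣+∣p∩q∣≡∣p∣+∣q∣ p q ⟩
  ∣ p ∣ + ∣ q ∣             ∎
  where
  open ≡-Reasoning
  p∩q≡⊥ : p ∩ q ≡ ⊥
  p∩q≡⊥ = Empty-unique (λ (z , z∈p∩q) → p∩q=∅ z (∩⁻ˡ z∈p∩q) (∩⁻ʳ z∈p∩q))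

∣⁅x⁆∪p∣≡1+∣p∣ : x ∉ p → ∣ ⁅ x ⁆ ∪ p ∣ ≡ suc ∣ p ∣
∣⁅x⁆∪p∣≡1+∣p∣ {x = x} {p = p} x∉p =
  trans (Disjoint⇒∣p∪q∣≡∣p∣+∣q∣ ⁅ x ⁆ p (λ _ y∈⁅x⁆ → subst (_∉ p) (sym (∈⁅⁆⇒≡ y∈⁅x⁆)) x∉p))
        (cong (_+ ∣ p ∣) (∣⁅x⁆∣≡1 x))

∣⁅x⁆∪⁅y⁆∣≡2 : x ≢ y → ∣ ⁅ x ⁆ ∪ ⁅ y ⁆ ∣ ≡ 2
∣⁅x⁆∪⁅y⁆∣≡2 {y = y} x≢y = trans (∣⁅x⁆∪p∣≡1+∣p∣ (x≢y ∘′ ∈⁅⁆⇒≡)) (cong suc (∣⁅x⁆∣≡1 y))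

x∈p⇒1≤∣p∣ : x ∈ p → 1 ≤ ∣ p ∣
x∈p⇒1≤∣p∣ {x = x} x∈p = subst (_≤ _) (∣⁅x⁆∣≡1 x) (p⊆q⇒∣p∣≤∣q∣ (⁅⁆⊆ x∈p))

x,y∈p⇒2≤∣p∣ : x ∈ p → y ∈ p → x ≢ y → 2 ≤ ∣ p ∣
x,y∈p⇒2≤∣p∣ x∈p y∈p x≢y =
  subst (_≤ _) (∣⁅x⁆∪⁅y⁆∣≡2 x≢y) (p⊆q⇒∣p∣≤∣q∣ (∪-lub (⁅⁆⊆ x∈p) (⁅⁆⊆ y∈p)))

∈-tabulate⁺ : {P : Fin n → Set} (P? : ∀ z → Dec (P z)) → P x → x ∈ tabulate (λ z → ⌊ P? z ⌋)
∈-tabulate⁺ {x = x} P? px = Vec.lookup⇒[]= x _ (trans (Vec.lookup∘tabulate _ x) (true-if (P? x)))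
  where
  true-if : (d : Dec _) → ⌊ d ⌋ ≡ true
  true-if (yes _)  = refl
  true-if (no ¬px) = ⊥-elim (¬px px)

∈-tabulate⁻ : {P : Fin n → Set} (P? : ∀ z → Dec (P z)) → x ∈ tabulate (λ z → ⌊ P? z ⌋) → P x
∈-tabulate⁻ {x = x} P? x∈ with P? x | trans (sym (Vec.lookup∘tabulate (λ z → ⌊ P? z ⌋) x)) (Vec.[]=⇒lookup x∈)
... | yes px | _ = px
... | no _   | ()

module _ {m : ℕ} (φ : Fin m → Fin n) (X : Subset m) where

  private
    InImage? : ∀ z → Dec (∃ λ i → φ i ≡ z × i ∈ X)
    InImage? z = any? (λ i → (φ i ≟ z) ×-dec (i ∈? X))

  ∈-image⁺ : ∀ i → i ∈ X → φ i ∈ image φ X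
  ∈-image⁺ i i∈X = ∈-tabulate⁺ InImage? (i , refl , i∈X)

  ∈-image⁻ : ∀ z → z ∈ image φ X → ∃ λ i → i ∈ X × φ i ≡ z
  ∈-image⁻ z z∈ with ∈-tabulate⁻ InImage? z∈
  ... | i , φi≡z , i∈X = i , i∈X , φi≡z

∣p∪⁅x⁆∣≤1+∣p∣ : ∀ (p : Subset n) x → ∣ p ∪ ⁅ x ⁆ ∣ ≤ suc ∣ p ∣
∣p∪⁅x⁆∣≤1+∣p∣ p x = ℕ.≤-trans (ℕ.m≤m+n _ _) (ℕ.≤-reflexive
  (trans (∣p∪q∣+∣p∩q∣≡∣p∣+∣q∣ p ⁅ x ⁆) (trans (cong (∣ p ∣ +_) (∣⁅x⁆∣≡1 x)) (ℕ.+-comm ∣ p ∣ 1))))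

∉∪ : x ∉ p → x ∉ q → x ∉ p ∪ q
∉∪ x∉p x∉q x∈p∪q = [ x∉p , x∉q ]′ (∪⁻ x∈p∪q)

∉⇒Disjoint : x ∉ p → Disjoint p ⁅ x ⁆
∉⇒Disjoint {p = p} x∉p y y∈p y∈⁅x⁆ = x∉p (subst (_∈ p) (∈⁅⁆⇒≡ y∈⁅x⁆) y∈p)

∉⇒Disjoint₂ : x ∉ p → y ∉ p → Disjoint p (⁅ x ⁆ ∪ ⁅ y ⁆)
∉⇒Disjoint₂ x∉p y∉p z z∈p z∈xy = [ ∉⇒Disjoint x∉p z z∈p , ∉⇒Disjoint y∉p z z∈p ]′ (∪⁻ z∈xy)

∪-swapʳ : ∀ (p q u : Subset n) → (p ∪ q) ∪ u ≡ (p ∪ u) ∪ q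
∪-swapʳ p q u = begin
  (p ∪ q) ∪ u  ≡⟨ ∪-assoc p q u ⟩
  p ∪ (q ∪ u)  ≡⟨ cong (p ∪_) (∪-comm q u) ⟩
  p ∪ (u ∪ q)  ≡⟨ ∪-assoc p u q ⟨
  (p ∪ u) ∪ q  ∎
  where open ≡-Reasoning

∈-∖⁅⁆ : x ∈ p → x ≢ y → x ∈ p ∩ ∁ ⁅ y ⁆
∈-∖⁅⁆ x∈p x≢y = ∩⁺ x∈p (∁⁺ (x≢y ∘′ ∈⁅⁆⇒≡))

∣p∖⁅x⁆∣<∣p∣ : x ∈ p → ∣ p ∩ ∁ ⁅ x ⁆ ∣ < ∣ p ∣
∣p∖⁅x⁆∣<∣p∣ {x = x} x∈p = p⊂q⇒∣p∣<∣q∣ (∩⁻ˡ , x , x∈p , λ x∈ → ∁⁻ (∩⁻ʳ x∈) (x∈⁅x⁆ x))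

∁⊥≡⊤ : ∁ ⊥ ≡ ⊤ {n}
∁⊥≡⊤ = ⊆-antisym ⊆⊤ (λ _ → ∁⁺ ∉⊥)

∁⊤≡⊥ : ∁ ⊤ ≡ ⊥ {n}
∁⊤≡⊥ = ⊆-antisym (λ x∈ → ⊥-elim (∁⁻ x∈ ∈⊤)) ⊥⊆

∁∁p≡p : ∀ (p : Subset n) → ∁ (∁ p) ≡ p
∁∁p≡p p = ⊆-antisym (x∉∁p⇒x∈p ∘′ ∁⁻) (∁⁺ ∘′ x∈p⇒x∉∁p)

injective⇒≤∣p∣ : ∀ {k} {ψ : Fin k → Fin n} → Injective _≡_ _≡_ ψ → (∀ i → ψ i ∈ p) → k ≤ ∣ p ∣
injective⇒≤∣p∣ {k = zero}  _           _    = z≤n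
injective⇒≤∣p∣ {k = suc k} {ψ} ψ-injective ψ∈p =
  ℕ.≤-trans (s≤s (injective⇒≤∣p∣ (suc-injective ∘′ ψ-injective) ψ∘suc∈)) (∣p∖⁅x⁆∣<∣p∣ (ψ∈p zero))
  where
  ψ∘suc∈ : ∀ i → ψ (suc i) ∈ _ ∩ ∁ ⁅ ψ zero ⁆
  ψ∘suc∈ i = ∈-∖⁅⁆ (ψ∈p (suc i)) (λ ψi≡ψ0 → 0≢1+n (sym (ψ-injective ψi≡ψ0)))

image-id : ∀ (p : Subset n) → image id p ≡ p
image-id p = ⊆-antisym image⊆ (λ {x} → ∈-image⁺ id p x)
  where
  image⊆ : image id p ⊆ p
  image⊆ {x} x∈ with ∈-image⁻ id p x x∈
  ... | _ , x∈p , refl = x∈p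

m≤n≤1+m∧n≢m⇒n≡1+m : ∀ {m n} → m ≤ n → n ≤ suc m → n ≢ m → n ≡ suc m
m≤n≤1+m∧n≢m⇒n≡1+m m≤n n≤1+m n≢m with ℕ.m≤n⇒m<n∨m≡n m≤n
... | inj₁ m<n = ℕ.≤-antisym n≤1+m m<n
... | inj₂ m≡n = ⊥-elim (n≢m (sym m≡n))

tight-sum : ∀ {r j a b} → r + j ≤ a + b → a ≤ j → b ≤ r → a ≡ j × b ≡ r
tight-sum {r} {j} {a} {b} r+j≤a+b a≤j b≤r =
  ℕ.≤-antisym a≤j (ℕ.+-cancelʳ-≤ r j a (ℕ.≤-trans (ℕ.≤-reflexive (ℕ.+-comm j r))
                                          (ℕ.≤-trans r+j≤a+b (ℕ.+-monoʳ-≤ a b≤r)))) ,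
  ℕ.≤-antisym b≤r (ℕ.+-cancelʳ-≤ j r b (ℕ.≤-trans r+j≤a+b
                                          (ℕ.≤-trans (ℕ.+-monoˡ-≤ b a≤j) (ℕ.≤-reflexive (ℕ.+-comm j b)))))

-- Rank-like functions

-- The rank function of a matroid up to the additive constant ρ ⊥.
record RankLike (n : ℕ) : Set where
  field
    ρ        : Subset n → ℕ
    ρ-mono   : ∀ {p q} → p ⊆ q → ρ p ≤ ρ q
    ρ-submod : ∀ p q → ρ (p ∪ q) + ρ (p ∩ q) ≤ ρ p + ρ q
    ρ-step   : ∀ p x → ρ (p ∪ ⁅ x ⁆) ≤ suc (ρ p)

module RankLikeProperties (R : RankLike n) where
  open RankLike R

  ρ-cong : p ⊆ q → q ⊆ p → ρ p ≡ ρ q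
  ρ-cong p⊆q q⊆p = cong ρ (⊆-antisym p⊆q q⊆p)

  Spans : Subset n → Fin n → Set
  Spans p x = ρ (p ∪ ⁅ x ⁆) ≡ ρ p

  spans-mono : p ⊆ q → Spans p x → Spans q x
  spans-mono {p} {q} {x} p⊆q p-spans = ℕ.≤-antisym (ℕ.+-cancelʳ-≤ (ρ p) _ _ (begin
    ρ (q ∪ ⁅ x ⁆) + ρ p                       ≤⟨ ℕ.+-mono-≤ (ρ-mono (∪-lub ∪⁺ˡ (∪⁺ʳ ∘′ ∪⁺ʳ)))
                                                             (ρ-mono (λ z∈p → ∩⁺ (p⊆q z∈p) (∪⁺ˡ z∈p))) ⟩
    ρ (q ∪ (p ∪ ⁅ x ⁆)) + ρ (q ∩ (p ∪ ⁅ x ⁆)) ≤⟨ ρ-submod q (p ∪ ⁅ x ⁆) ⟩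
    ρ q + ρ (p ∪ ⁅ x ⁆)                       ≡⟨ cong (ρ q +_) p-spans ⟩
    ρ q + ρ p                                 ∎))
    (ρ-mono ∪⁺ˡ)
    where open ℕ.≤-Reasoning

  private
    spans-all-by : ∀ k p q → ∣ q ∩ ∁ p ∣ ≤ k → (∀ x → x ∈ q → Spans p x) → ρ (p ∪ q) ≡ ρ p
    spans-all-by k p q _ q-spanned with nonempty? (q ∩ ∁ p)
    ... | no q∖p-empty = ρ-cong (∪-lub id q⊆p) ∪⁺ˡ
      where
      q⊆p : q ⊆ p
      q⊆p {z} z∈q with z ∈? p
      ... | yes z∈p = z∈p
      ... | no z∉p  = ⊥-elim (q∖p-empty (z , ∩⁺ z∈q (∁⁺ z∉p)))
    spans-all-by zero    p q size _ | yes (x , x∈) = ⊥-elim (ℕ.<⇒≱ (x∈p⇒1≤∣p∣ x∈) size)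
    spans-all-by (suc k) p q size q-spanned | yes (x , x∈) =
      ℕ.≤-antisym (ℕ.≤-trans (ρ-mono (∪-lub (∪⁺ˡ ∘′ ∪⁺ˡ) ∪⁺ʳ)) (ℕ.≤-reflexive (trans ih (q-spanned x (∩⁻ˡ x∈)))))
                  (ρ-mono ∪⁺ˡ)
      where
      p′ = p ∪ ⁅ x ⁆
      smaller : q ∩ ∁ p′ ⊂ q ∩ ∁ p
      smaller = (λ z∈ → ∩⁺ (∩⁻ˡ z∈) (∁⁺ (∁⁻ (∩⁻ʳ z∈) ∘′ ∪⁺ˡ)))
              , x , x∈ , (λ x∈′ → ∁⁻ (∩⁻ʳ x∈′) (∪⁺ʳ (x∈⁅x⁆ x)))
      ih : ρ (p′ ∪ q) ≡ ρ p′
      ih = spans-all-by k p′ q (ℕ.≤-pred (ℕ.≤-trans (p⊂q⇒∣p∣<∣q∣ smaller) size))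
                        (λ z z∈q → spans-mono ∪⁺ˡ (q-spanned z z∈q))

  spans-all : (∀ x → x ∈ q → Spans p x) → ρ (p ∪ q) ≡ ρ p
  spans-all {q} {p} = spans-all-by _ p q ℕ.≤-refl

rk≤rk+∣∣ : (M : Matroid n) → ∀ p q → rk M (p ∪ q) ≤ rk M p + ∣ q ∣
rk≤rk+∣∣ M p q = ℕ.≤-trans (ℕ.m≤m+n _ _) (ℕ.≤-trans (rk-submod M p q) (ℕ.+-monoʳ-≤ (rk M p) (rk-bound M q)))

matroidRank : Matroid n → RankLike n
matroidRank M = record
  { ρ        = rk M
  ; ρ-mono   = rk-mono M
  ; ρ-submod = rk-submod M
  ; ρ-step   = λ p x → subst (rk M (p ∪ ⁅ x ⁆) ≤_) (trans (cong (rk M p +_) (∣⁅x⁆∣≡1 x)) (ℕ.+-comm (rk M p) 1))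
                             (rk≤rk+∣∣ M p ⁅ x ⁆)
  }

contraction : RankLike n → Subset n → RankLike n
contraction R K = record
  { ρ        = λ p → ρ (p ∪ K)
  ; ρ-mono   = λ p⊆q → ρ-mono (∪-lub (∪⁺ˡ ∘′ p⊆q) ∪⁺ʳ)
  ; ρ-submod = λ p q → ℕ.≤-trans
      (ℕ.+-mono-≤ (ρ-mono (∪-lub (∪-lub (∪⁺ˡ ∘′ ∪⁺ˡ) (∪⁺ʳ ∘′ ∪⁺ˡ)) (∪⁺ˡ ∘′ ∪⁺ʳ)))
                  (ρ-mono (∪-lub (λ z∈ → ∩⁺ (∪⁺ˡ (∩⁻ˡ z∈)) (∪⁺ˡ (∩⁻ʳ z∈))) (λ z∈ → ∩⁺ (∪⁺ʳ z∈) (∪⁺ʳ z∈)))))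
      (ρ-submod (p ∪ K) (q ∪ K))
  ; ρ-step   = λ p x → ℕ.≤-trans (ρ-mono (∪-lub (∪-lub (∪⁺ˡ ∘′ ∪⁺ˡ) ∪⁺ʳ) (∪⁺ˡ ∘′ ∪⁺ʳ))) (ρ-step (p ∪ K) x)
  }
  where open RankLike R

-- The rank function of the dual matroid, shifted by r(E).
dualRank : Matroid n → RankLike n
dualRank M = record
  { ρ        = λ p → ∣ p ∣ + r (∁ p)
  ; ρ-mono   = mono
  ; ρ-submod = submod
  ; ρ-step   = λ p x → ℕ.+-mono-≤ (∣p∪⁅x⁆∣≤1+∣p∣ p x) (rk-mono M (p⊆q⇒∁p⊇∁q ∪⁺ˡ))
  }
  where
  r = rk M

  mono : p ⊆ q → ∣ p ∣ + r (∁ p) ≤ ∣ q ∣ + r (∁ q)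
  mono {p = p} {q = q} p⊆q = begin
    ∣ p ∣ + r (∁ p)                ≤⟨ ℕ.+-monoʳ-≤ ∣ p ∣ (rk-mono M ∁p⊆∁q∪d) ⟩
    ∣ p ∣ + r (∁ q ∪ d)            ≤⟨ ℕ.+-monoʳ-≤ ∣ p ∣ (rk≤rk+∣∣ M (∁ q) d) ⟩
    ∣ p ∣ + (r (∁ q) + ∣ d ∣)      ≡⟨ cong (∣ p ∣ +_) (ℕ.+-comm (r (∁ q)) ∣ d ∣) ⟩
    ∣ p ∣ + (∣ d ∣ + r (∁ q))      ≡⟨ ℕ.+-assoc ∣ p ∣ ∣ d ∣ _ ⟨
    ∣ p ∣ + ∣ d ∣ + r (∁ q)        ≡⟨ cong (_+ r (∁ q)) ∣p∣+∣d∣≡∣q∣ ⟩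
    ∣ q ∣ + r (∁ q)                ∎
    where
    open ℕ.≤-Reasoning
    d = q ∩ ∁ p
    ∁p⊆∁q∪d : ∁ p ⊆ ∁ q ∪ d
    ∁p⊆∁q∪d {z} z∈∁p with z ∈? q
    ... | yes z∈q = ∪⁺ʳ (∩⁺ z∈q z∈∁p)
    ... | no z∉q  = ∪⁺ˡ (∁⁺ z∉q)
    q⊆p∪d : q ⊆ p ∪ d
    q⊆p∪d {z} z∈q with z ∈? p
    ... | yes z∈p = ∪⁺ˡ z∈p
    ... | no z∉p  = ∪⁺ʳ (∩⁺ z∈q (∁⁺ z∉p))
    ∣p∣+∣d∣≡∣q∣ : ∣ p ∣ + ∣ d ∣ ≡ ∣ q ∣
    ∣p∣+∣d∣≡∣q∣ = trans (sym (Disjoint⇒∣p∪q∣≡∣p∣+∣q∣ p d (λ _ z∈p z∈d → ∁⁻ (∩⁻ʳ z∈d) z∈p)))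
                        (cong ∣_∣ (⊆-antisym (∪-lub p⊆q ∩⁻ˡ) q⊆p∪d))

  submod : ∀ p q → (∣ p ∪ q ∣ + r (∁ (p ∪ q))) + (∣ p ∩ q ∣ + r (∁ (p ∩ q)))
                   ≤ (∣ p ∣ + r (∁ p)) + (∣ q ∣ + r (∁ q))
  submod p q = begin
    (∣ p ∪ q ∣ + r (∁ (p ∪ q))) + (∣ p ∩ q ∣ + r (∁ (p ∩ q))) ≡⟨ interchange ∣ p ∪ q ∣ _ _ _ ⟩
    (∣ p ∪ q ∣ + ∣ p ∩ q ∣) + (r (∁ (p ∪ q)) + r (∁ (p ∩ q))) ≤⟨ ℕ.+-mono-≤ (ℕ.≤-reflexive (∣p∪q∣+∣p∩q∣≡∣p∣+∣q∣ p q))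
                                                                  (ℕ.+-mono-≤ (rk-mono M ∁∪⊆) (rk-mono M ∁∩⊆)) ⟩
    (∣ p ∣ + ∣ q ∣) + (r (∁ p ∩ ∁ q) + r (∁ p ∪ ∁ q))         ≡⟨ cong ((∣ p ∣ + ∣ q ∣) +_) (ℕ.+-comm (r (∁ p ∩ ∁ q)) _) ⟩
    (∣ p ∣ + ∣ q ∣) + (r (∁ p ∪ ∁ q) + r (∁ p ∩ ∁ q))         ≤⟨ ℕ.+-monoʳ-≤ (∣ p ∣ + ∣ q ∣) (rk-submod M (∁ p) (∁ q)) ⟩
    (∣ p ∣ + ∣ q ∣) + (r (∁ p) + r (∁ q))                     ≡⟨ interchange ∣ p ∣ _ _ _ ⟩
    (∣ p ∣ + r (∁ p)) + (∣ q ∣ + r (∁ q))                     ∎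
    where
    open ℕ.≤-Reasoning
    ∁∪⊆ : ∁ (p ∪ q) ⊆ ∁ p ∩ ∁ q
    ∁∪⊆ z∈ = ∩⁺ (∁⁺ (∁⁻ z∈ ∘′ ∪⁺ˡ)) (∁⁺ (∁⁻ z∈ ∘′ ∪⁺ʳ))
    ∁∩⊆ : ∁ (p ∩ q) ⊆ ∁ p ∪ ∁ q
    ∁∩⊆ {z} z∈ with z ∈? p
    ... | yes z∈p = ∪⁺ʳ (∁⁺ (∁⁻ z∈ ∘′ ∩⁺ z∈p))
    ... | no z∉p  = ∪⁺ˡ (∁⁺ z∉p)

module DualRank (M : Matroid n) where
  open RankLike (dualRank M) renaming (ρ to ρ*) public

  ρ*⊥≡rank : ρ* ⊥ ≡ rank M
  ρ*⊥≡rank = cong₂ _+_ (∣⊥∣≡0 n) (cong (rk M) ∁⊥≡⊤)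

  ρ*≤n : ∀ p → ρ* p ≤ n
  ρ*≤n p = ℕ.≤-trans (ρ-mono ⊆⊤) (ℕ.≤-reflexive (trans (cong₂ _+_ (∣⊤∣≡n n) rk∁⊤≡0) (ℕ.+-identityʳ n)))
    where
    rk∁⊤≡0 : rk M (∁ ⊤) ≡ 0
    rk∁⊤≡0 = ℕ.n≤0⇒n≡0 (ℕ.≤-trans (rk-mono M (⊆-reflexive ∁⊤≡⊥)) (ℕ.≤-trans (rk-bound M ⊥) (ℕ.≤-reflexive (∣⊥∣≡0 n))))

  -- Connectivity is self-dual.
  ρ*+ρ*∁≡n+rk+rk∁ : ∀ p → ρ* p + ρ* (∁ p) ≡ n + (rk M p + rk M (∁ p))
  ρ*+ρ*∁≡n+rk+rk∁ p = begin
    (∣ p ∣ + rk M (∁ p)) + (∣ ∁ p ∣ + rk M (∁ (∁ p))) ≡⟨ cong (λ q → ρ* p + (∣ ∁ p ∣ + rk M q)) (∁∁p≡p p) ⟩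
    (∣ p ∣ + rk M (∁ p)) + (∣ ∁ p ∣ + rk M p)         ≡⟨ interchange ∣ p ∣ _ _ _ ⟩
    (∣ p ∣ + ∣ ∁ p ∣) + (rk M (∁ p) + rk M p)         ≡⟨ cong₂ _+_ (∣p∣+∣∁p∣≡n p) (ℕ.+-comm (rk M (∁ p)) _) ⟩
    n + (rk M p + rk M (∁ p))                         ∎
    where open ≡-Reasoning

  -- In M / (E − Z), the rank of D ⊆ Z is |D| − (ρ* Z − ρ* (Z − D)); here it is one.
  rk[∁Z∪D]≡1+rk[∁Z] : ∀ {Y D Z} → Disjoint Y D → Y ∪ D ≡ Z → ρ* Y + ∣ D ∣ ≡ suc (ρ* Z) →
                      rk M (∁ Z ∪ D) ≡ suc (rk M (∁ Z))
  rk[∁Z∪D]≡1+rk[∁Z] {Y} {D} disjoint refl ρ*-eq = ℕ.+-cancelˡ-≡ (∣ Y ∣ + ∣ D ∣) _ _ (begin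
    (∣ Y ∣ + ∣ D ∣) + rk M (∁ Z ∪ D)    ≡⟨ swap₂₃ ∣ Y ∣ ∣ D ∣ _ ⟩
    (∣ Y ∣ + rk M (∁ Z ∪ D)) + ∣ D ∣    ≡⟨ cong (λ q → (∣ Y ∣ + rk M q) + ∣ D ∣) ∁Y≡∁Z∪D ⟨
    ρ* Y + ∣ D ∣                        ≡⟨ ρ*-eq ⟩
    suc (∣ Z ∣ + rk M (∁ Z))            ≡⟨ ℕ.+-suc ∣ Z ∣ _ ⟨
    ∣ Z ∣ + suc (rk M (∁ Z))            ≡⟨ cong (_+ suc (rk M (∁ Z))) (Disjoint⇒∣p∪q∣≡∣p∣+∣q∣ Y D disjoint) ⟩
    (∣ Y ∣ + ∣ D ∣) + suc (rk M (∁ Z))  ∎)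
    where
    open ≡-Reasoning
    Z = Y ∪ D
    swap₂₃ : ∀ a b c → (a + b) + c ≡ (a + c) + b
    swap₂₃ = solve-∀
    ∁Y≡∁Z∪D : ∁ Y ≡ ∁ Z ∪ D
    ∁Y≡∁Z∪D = ⊆-antisym ∁Y⊆ (∪-lub (p⊆q⇒∁p⊇∁q ∪⁺ˡ) (λ {x} x∈D → ∁⁺ (λ x∈Y → disjoint x x∈Y x∈D)))
      where
      ∁Y⊆ : ∁ Y ⊆ ∁ Z ∪ D
      ∁Y⊆ {x} x∈∁Y with x ∈? D
      ... | yes x∈D = ∪⁺ʳ x∈D
      ... | no x∉D  = ∪⁺ˡ (∁⁺ (λ x∈Z → [ ∁⁻ x∈∁Y , x∉D ]′ (∪⁻ x∈Z)))

-- Parallel pairs versus separations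

module _ (R : RankLike n) where
  open RankLike R

  Parallel : Subset n → Fin n → Fin n → Set
  Parallel C e f = ρ (C ∪ ⁅ e ⁆) ≡ suc (ρ C) × ρ (C ∪ ⁅ f ⁆) ≡ suc (ρ C)
                 × ρ (C ∪ (⁅ e ⁆ ∪ ⁅ f ⁆)) ≡ suc (ρ C)

  ParallelWithin : Subset n → Fin n → Fin n → Set
  ParallelWithin T e f = ∃ λ C → C ⊆ T × e ∉ C × f ∉ C × Parallel C e f

  -- A has connectivity 0 in the restriction of R to T.
  Separation : Subset n → Fin n → Fin n → Subset n → Set
  Separation T e f A = A ⊆ T × e ∈ A × f ∉ A × ρ A + ρ (T ∩ ∁ A) ≤ ρ T + ρ ⊥

private
  no-split-squeeze : ∀ {b e f f′ t} → f′ ≤ f → e ≤ suc b → f ≤ suc b → f ≤ t → e ≤ t →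
                     t + b < e + f′ → e ≡ suc b × f ≡ suc b × t ≡ suc b
  no-split-squeeze {b} {e} {f} {f′} {t} f′≤f e≤ f≤ f≤t e≤t split-fails = e≡ , f≡ , trans t≡e e≡
    where
    b<f′ : b < f′
    b<f′ = ℕ.+-cancelˡ-< t b f′ (ℕ.<-≤-trans split-fails (ℕ.+-monoˡ-≤ f′ e≤t))
    f≡ : f ≡ suc b
    f≡ = ℕ.≤-antisym f≤ (ℕ.≤-trans b<f′ f′≤f)
    t≡e : t ≡ e
    t≡e = ℕ.≤-antisym (ℕ.+-cancelʳ-≤ b t e (ℕ.≤-pred (begin
      suc (t + b)      ≤⟨ split-fails ⟩
      e + f′           ≤⟨ ℕ.+-monoʳ-≤ e (ℕ.≤-trans f′≤f f≤) ⟩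
      e + suc b        ≡⟨ ℕ.+-suc e b ⟩
      suc (e + b)      ∎))) e≤t
      where open ℕ.≤-Reasoning
    e≡ : e ≡ suc b
    e≡ = ℕ.≤-antisym e≤ (subst (suc b ≤_) t≡e (subst (_≤ t) f≡ f≤t))

  split-pick : ∀ a b c d s → (a + b) + (c + d) ≤ s + suc s → ¬ (b + c ≤ s) → a + d ≤ s
  split-pick a b c d s sum≤ b+c≰s = ℕ.+-cancelˡ-≤ (suc s) _ _ (begin
    suc s + (a + d)    ≤⟨ ℕ.+-monoˡ-≤ (a + d) (ℕ.≰⇒> b+c≰s) ⟩
    (b + c) + (a + d)  ≡⟨ rearrange a b c d ⟩
    (a + b) + (c + d)  ≤⟨ sum≤ ⟩
    s + suc s          ≡⟨ ℕ.+-comm s (suc s) ⟩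
    suc s + s          ∎)
    where
    open ℕ.≤-Reasoning
    rearrange : ∀ a b c d → (b + c) + (a + d) ≡ (a + b) + (c + d)
    rearrange = solve-∀

module _ (R : RankLike n) {T : Subset n} {e f : Fin n} (e≢f : e ≢ f) (e∈T : e ∈ T) (f∈T : f ∈ T) where
  open RankLike R
  open RankLikeProperties R

  pair-parallel-or-separation : (∀ {z} → z ∈ T → z ≡ e ⊎ z ≡ f) →
                                ParallelWithin R T e f ⊎ ∃ (Separation R T e f)
  pair-parallel-or-separation only-e-f with ρ ⁅ e ⁆ + ρ (T ∩ ∁ ⁅ e ⁆) ≤? ρ T + ρ ⊥
  ... | yes split = inj₂ (⁅ e ⁆ , ⁅⁆⊆ e∈T , x∈⁅x⁆ e , e≢f ∘′ sym ∘′ ∈⁅⁆⇒≡ , split)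
  ... | no split-fails = inj₁ (⊥ , ⊥⊆ , ∉⊥ , ∉⊥ , ρ⊥∪ ⁅ e ⁆ ρe , ρ⊥∪ ⁅ f ⁆ ρf , ρ⊥∪ (⁅ e ⁆ ∪ ⁅ f ⁆) ρef)
    where
    ef⊆T : ⁅ e ⁆ ∪ ⁅ f ⁆ ⊆ T
    ef⊆T = ∪-lub (⁅⁆⊆ e∈T) (⁅⁆⊆ f∈T)
    T⊆ef : T ⊆ ⁅ e ⁆ ∪ ⁅ f ⁆
    T⊆ef {z} z∈T with only-e-f z∈T
    ... | inj₁ refl = ∪⁺ˡ (x∈⁅x⁆ e)
    ... | inj₂ refl = ∪⁺ʳ (x∈⁅x⁆ f)
    T∖e⊆f : T ∩ ∁ ⁅ e ⁆ ⊆ ⁅ f ⁆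
    T∖e⊆f z∈ with only-e-f (∩⁻ˡ z∈)
    ... | inj₁ refl = ⊥-elim (∁⁻ (∩⁻ʳ z∈) (x∈⁅x⁆ e))
    ... | inj₂ refl = x∈⁅x⁆ f
    ρ⁅⁆≤ : ∀ x → ρ ⁅ x ⁆ ≤ suc (ρ ⊥)
    ρ⁅⁆≤ x = ℕ.≤-trans (ρ-mono ∪⁺ʳ) (ρ-step ⊥ x)
    squeezed = no-split-squeeze (ρ-mono T∖e⊆f) (ρ⁅⁆≤ e) (ρ⁅⁆≤ f)
                 (ρ-mono (⁅⁆⊆ f∈T)) (ρ-mono (⁅⁆⊆ e∈T)) (ℕ.≰⇒> split-fails)
    ρe = proj₁ squeezed
    ρf = proj₁ (proj₂ squeezed)
    ρef = trans (ρ-cong ef⊆T T⊆ef) (proj₂ (proj₂ squeezed))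
    ρ⊥∪ : ∀ p → ρ p ≡ suc (ρ ⊥) → ρ (⊥ ∪ p) ≡ suc (ρ ⊥)
    ρ⊥∪ p = trans (ρ-cong (∪-lub ⊥⊆ id) ∪⁺ʳ)

module _ (R : RankLike n) {T : Subset n} {e f z : Fin n} (z∈T : z ∈ T) (z≢e : z ≢ e) (z≢f : z ≢ f) where
  open RankLike R
  open RankLikeProperties R

  private
    T′ = T ∩ ∁ ⁅ z ⁆
    Rz = contraction R ⁅ z ⁆

  parallel-after-contraction : ParallelWithin Rz T′ e f → ParallelWithin R T e f
  parallel-after-contraction (C , C⊆T′ , e∉C , f∉C , ρe , ρf , ρef) =
    C ∪ ⁅ z ⁆ , ∪-lub (∩⁻ˡ ∘′ C⊆T′) (⁅⁆⊆ z∈T) , ∉C∪z e∉C z≢e , ∉C∪z f∉C z≢f ,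
    trans (swap ⁅ e ⁆) ρe , trans (swap ⁅ f ⁆) ρf , trans (swap (⁅ e ⁆ ∪ ⁅ f ⁆)) ρef
    where
    ∉C∪z : x ∉ C → z ≢ x → x ∉ C ∪ ⁅ z ⁆
    ∉C∪z x∉C z≢x x∈ with ∪⁻ x∈
    ... | inj₁ x∈C = x∉C x∈C
    ... | inj₂ x∈z = z≢x (sym (∈⁅⁆⇒≡ x∈z))
    swap : ∀ Y → ρ ((C ∪ ⁅ z ⁆) ∪ Y) ≡ ρ ((C ∪ Y) ∪ ⁅ z ⁆)
    swap Y = cong ρ (∪-swapʳ C ⁅ z ⁆ Y)

  -- With X = A ∩ A′ and Y = (T′ − A) ∩ (T′ − A′), submodularity gives λ(X) + λ(T − Y) ≤ 1
  -- in the restriction to T, so X or T − Y separates e from f.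
  separation-by-uncrossing : ∀ {A A′} → f ∈ T → Separation R T′ e f A → Separation Rz T′ e f A′ →
                             ∃ (Separation R T e f)
  separation-by-uncrossing {A} {A′} f∈T (A⊆T′ , e∈A , f∉A , sepA) (_ , e∈A′ , f∉A′ , sepA′) =
    choose (ρ X + ρ (T ∩ ∁ X) ≤? s)
    where
    Z = ⁅ z ⁆
    X = A ∩ A′
    Y = (T′ ∩ ∁ A) ∩ (T′ ∩ ∁ A′)
    s = ρ T + ρ ⊥
    f∈T′ : f ∈ T′
    f∈T′ = ∈-∖⁅⁆ f∈T (z≢f ∘′ sym)

    T∖Y⊆ : T ∩ ∁ Y ⊆ A ∪ (A′ ∪ Z)
    T∖Y⊆ {x} x∈ with x ≟ z
    ... | yes refl = ∪⁺ʳ (∪⁺ʳ (x∈⁅x⁆ z))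
    ... | no x≢z with x ∈? A | x ∈? A′
    ...   | yes x∈A | _         = ∪⁺ˡ x∈A
    ...   | no _    | yes x∈A′  = ∪⁺ʳ (∪⁺ˡ x∈A′)
    ...   | no x∉A  | no x∉A′   = ⊥-elim (∁⁻ (∩⁻ʳ x∈) (∩⁺ (∩⁺ x∈T′ (∁⁺ x∉A)) (∩⁺ x∈T′ (∁⁺ x∉A′))))
      where x∈T′ = ∈-∖⁅⁆ (∩⁻ˡ x∈) x≢z

    T∖X⊆ : T ∩ ∁ X ⊆ (T′ ∩ ∁ A) ∪ ((T′ ∩ ∁ A′) ∪ Z)
    T∖X⊆ {x} x∈ with x ≟ z
    ... | yes refl = ∪⁺ʳ (∪⁺ʳ (x∈⁅x⁆ z))
    ... | no x≢z with x ∈? A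
    ...   | no x∉A  = ∪⁺ˡ (∩⁺ (∈-∖⁅⁆ (∩⁻ˡ x∈) x≢z) (∁⁺ x∉A))
    ...   | yes x∈A = ∪⁺ʳ (∪⁺ˡ (∩⁺ (∈-∖⁅⁆ (∩⁻ˡ x∈) x≢z) (∁⁺ (∁⁻ (∩⁻ʳ x∈) ∘′ ∩⁺ x∈A))))

    submod-A : ρ (T ∩ ∁ Y) + ρ X ≤ ρ A + ρ (A′ ∪ Z)
    submod-A = ℕ.≤-trans (ℕ.+-mono-≤ (ρ-mono T∖Y⊆) (ρ-mono (λ x∈ → ∩⁺ (∩⁻ˡ x∈) (∪⁺ˡ (∩⁻ʳ x∈)))))
                         (ρ-submod A (A′ ∪ Z))

    submod-T∖A : ρ (T ∩ ∁ X) + ρ Y ≤ ρ (T′ ∩ ∁ A) + ρ ((T′ ∩ ∁ A′) ∪ Z)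
    submod-T∖A = ℕ.≤-trans (ℕ.+-mono-≤ (ρ-mono T∖X⊆) (ρ-mono (λ x∈ → ∩⁺ (∩⁻ˡ x∈) (∪⁺ˡ (∩⁻ʳ x∈)))))
                           (ρ-submod (T′ ∩ ∁ A) ((T′ ∩ ∁ A′) ∪ Z))

    total : (ρ (T ∩ ∁ Y) + ρ X) + (ρ (T ∩ ∁ X) + ρ Y) ≤ s + suc s
    total = begin
      (ρ (T ∩ ∁ Y) + ρ X) + (ρ (T ∩ ∁ X) + ρ Y)                 ≤⟨ ℕ.+-mono-≤ submod-A submod-T∖A ⟩
      (ρ A + ρ (A′ ∪ Z)) + (ρ (T′ ∩ ∁ A) + ρ ((T′ ∩ ∁ A′) ∪ Z)) ≡⟨ interchange (ρ A) _ _ _ ⟩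
      (ρ A + ρ (T′ ∩ ∁ A)) + (ρ (A′ ∪ Z) + ρ ((T′ ∩ ∁ A′) ∪ Z)) ≤⟨ ℕ.+-mono-≤ sepA sepA′ ⟩
      (ρ T′ + ρ ⊥) + (ρ (T′ ∪ Z) + ρ (⊥ ∪ Z))                   ≤⟨ ℕ.+-mono-≤ (ℕ.+-monoˡ-≤ (ρ ⊥) (ρ-mono ∩⁻ˡ))
                                                                      (ℕ.+-mono-≤ (ρ-mono (∪-lub ∩⁻ˡ (⁅⁆⊆ z∈T))) (ρ-step ⊥ z)) ⟩
      s + (ρ T + suc (ρ ⊥))                                       ≡⟨ cong (s +_) (ℕ.+-suc (ρ T) (ρ ⊥)) ⟩
      s + suc s                                                   ∎
      where open ℕ.≤-Reasoning

    choose : Dec (ρ X + ρ (T ∩ ∁ X) ≤ s) → ∃ (Separation R T e f)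
    choose (yes split) = X , ∩⁻ˡ ∘′ A⊆T′ ∘′ ∩⁻ˡ , ∩⁺ e∈A e∈A′ , f∉A ∘′ ∩⁻ˡ , split
    choose (no split-fails) =
      T ∩ ∁ Y , ∩⁻ˡ , ∩⁺ (∩⁻ˡ (A⊆T′ e∈A)) (∁⁺ (λ e∈Y → ∁⁻ (∩⁻ʳ (∩⁻ˡ e∈Y)) e∈A)) ,
      (λ f∈ → ∁⁻ (∩⁻ʳ f∈) (∩⁺ (∩⁺ f∈T′ (∁⁺ f∉A)) (∩⁺ f∈T′ (∁⁺ f∉A′)))) ,
      ℕ.≤-trans (ℕ.+-monoʳ-≤ (ρ (T ∩ ∁ Y)) (ρ-mono T∖[T∖Y]⊆Y))
                (split-pick (ρ (T ∩ ∁ Y)) (ρ X) (ρ (T ∩ ∁ X)) (ρ Y) s total split-fails)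
      where
      T∖[T∖Y]⊆Y : T ∩ ∁ (T ∩ ∁ Y) ⊆ Y
      T∖[T∖Y]⊆Y {x} x∈ with x ∈? Y
      ... | yes x∈Y = x∈Y
      ... | no x∉Y  = ⊥-elim (∁⁻ (∩⁻ʳ x∈) (∩⁺ (∩⁻ˡ x∈) (∁⁺ x∉Y)))

private
  parallel-or-separation-by : ∀ k (R : RankLike n) {T e f} → ∣ T ∣ ≤ k → e ≢ f → e ∈ T → f ∈ T →
                              ParallelWithin R T e f ⊎ ∃ (Separation R T e f)
  parallel-or-separation-by zero R size e≢f e∈T f∈T = ⊥-elim (ℕ.<⇒≱ (x∈p⇒1≤∣p∣ e∈T) size)
  parallel-or-separation-by (suc k) R {T} {e} {f} size e≢f e∈T f∈T
    with any? (λ z → (z ∈? T) ×-dec (¬? (z ≟ e) ×-dec ¬? (z ≟ f)))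
  ... | no no-third = pair-parallel-or-separation R e≢f e∈T f∈T T⊆ef
    where
    T⊆ef : x ∈ T → x ≡ e ⊎ x ≡ f
    T⊆ef {x} x∈T with x ≟ e | x ≟ f
    ... | yes x≡e | _       = inj₁ x≡e
    ... | no _    | yes x≡f = inj₂ x≡f
    ... | no x≢e  | no x≢f  = ⊥-elim (no-third (x , x∈T , x≢e , x≢f))
  ... | yes (z , z∈T , z≢e , z≢f) = combine (parallel-or-separation-by k R size′ e≢f e∈T′ f∈T′)
                                            (parallel-or-separation-by k Rz size′ e≢f e∈T′ f∈T′)
    where
    T′ = T ∩ ∁ ⁅ z ⁆
    Rz = contraction R ⁅ z ⁆
    size′ = ℕ.≤-pred (ℕ.≤-trans (∣p∖⁅x⁆∣<∣p∣ z∈T) size)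
    e∈T′ = ∈-∖⁅⁆ e∈T (z≢e ∘′ sym)
    f∈T′ = ∈-∖⁅⁆ f∈T (z≢f ∘′ sym)
    combine : ParallelWithin R T′ e f ⊎ ∃ (Separation R T′ e f) →
              ParallelWithin Rz T′ e f ⊎ ∃ (Separation Rz T′ e f) →
              ParallelWithin R T e f ⊎ ∃ (Separation R T e f)
    combine (inj₁ (C , C⊆T′ , rest)) _ = inj₁ (C , ∩⁻ˡ ∘′ C⊆T′ , rest)
    combine (inj₂ _) (inj₁ par) = inj₁ (parallel-after-contraction R z∈T z≢e z≢f par)
    combine (inj₂ (_ , sep)) (inj₂ (_ , sep′)) = inj₂ (separation-by-uncrossing R z∈T z≢e z≢f f∈T sep sep′)

parallel-or-separation : ∀ (R : RankLike n) {T e f} → e ≢ f → e ∈ T → f ∈ T →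
                         ParallelWithin R T e f ⊎ ∃ (Separation R T e f)
parallel-or-separation R {T} = parallel-or-separation-by ∣ T ∣ R ℕ.≤-refl

module _ (R : RankLike n) where
  open RankLike R

  parallel? : ∀ C e f → Dec (Parallel R C e f)
  parallel? C e f = (ρ (C ∪ ⁅ e ⁆) ℕ.≟ suc (ρ C)) ×-dec (ρ (C ∪ ⁅ f ⁆) ℕ.≟ suc (ρ C))
                    ×-dec (ρ (C ∪ (⁅ e ⁆ ∪ ⁅ f ⁆)) ℕ.≟ suc (ρ C))

  MinimalParallel : Subset n → Fin n → Fin n → Set
  MinimalParallel C e f = Parallel R C e f × (∀ c → c ∈ C → ¬ Parallel R (C ∩ ∁ ⁅ c ⁆) e f)

private
  minimal-parallel-by : ∀ k (R : RankLike n) {C e f} → ∣ C ∣ ≤ k → Parallel R C e f →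
                        ∃ λ C′ → C′ ⊆ C × MinimalParallel R C′ e f
  minimal-parallel-by k R {C} {e} {f} size par
    with any? (λ c → (c ∈? C) ×-dec parallel? R (C ∩ ∁ ⁅ c ⁆) e f)
  ... | no minimal = C , id , par , λ c c∈C par′ → minimal (c , c∈C , par′)
  minimal-parallel-by zero R size par | yes (c , c∈C , _) = ⊥-elim (ℕ.<⇒≱ (x∈p⇒1≤∣p∣ c∈C) size)
  minimal-parallel-by (suc k) R size par | yes (c , c∈C , par′)
    with minimal-parallel-by k R (ℕ.≤-pred (ℕ.≤-trans (∣p∖⁅x⁆∣<∣p∣ c∈C) size)) par′
  ... | C′ , C′⊆ , minpar = C′ , ∩⁻ˡ ∘′ C′⊆ , minpar

minimal-parallel : ∀ (R : RankLike n) {C e f} → Parallel R C e f → ∃ λ C′ → C′ ⊆ C × MinimalParallel R C′ e f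
minimal-parallel R {C} = minimal-parallel-by ∣ C ∣ R ℕ.≤-refl

-- For minimal C and c ∈ C, the elements c, e, f form a triangle in the contraction by C − c.
module MinimalParallelProperties (R : RankLike n) {C : Subset n} {e f : Fin n}
         (minpar : MinimalParallel R C e f) {c : Fin n} (c∈C : c ∈ C) where
  open RankLike R
  open RankLikeProperties R

  C′ = C ∩ ∁ ⁅ c ⁆

  C′∪c≡C : C′ ∪ ⁅ c ⁆ ≡ C
  C′∪c≡C = ⊆-antisym (∪-lub ∩⁻ˡ (⁅⁆⊆ c∈C)) C⊆
    where
    C⊆ : C ⊆ C′ ∪ ⁅ c ⁆
    C⊆ {x} x∈C with x ≟ c
    ... | yes refl = ∪⁺ʳ (x∈⁅x⁆ c)
    ... | no x≢c   = ∪⁺ˡ (∈-∖⁅⁆ x∈C x≢c)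

  private
    par = proj₁ minpar
    ρ[C∪Y] : ∀ Y → ρ (C ∪ Y) ≡ ρ ((C′ ∪ Y) ∪ ⁅ c ⁆)
    ρ[C∪Y] Y = trans (cong (λ D → ρ (D ∪ Y)) (sym C′∪c≡C)) (cong ρ (∪-swapʳ C′ ⁅ c ⁆ Y))
    ρ[C]≤1+ρ[C′] : ρ C ≤ suc (ρ C′)
    ρ[C]≤1+ρ[C′] = subst (λ D → ρ D ≤ suc (ρ C′)) C′∪c≡C (ρ-step C′ c)

  ρ[C]≡1+ρ[C′] : ρ C ≡ suc (ρ C′)
  ρ[C]≡1+ρ[C′] = m≤n≤1+m∧n≢m⇒n≡1+m (ρ-mono ∩⁻ˡ) ρ[C]≤1+ρ[C′] ρ[C]≢ρ[C′]
    where
    ρ[C]≢ρ[C′] : ρ C ≢ ρ C′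
    ρ[C]≢ρ[C′] ρC≡ρC′ = proj₂ minpar c c∈C (lift (proj₁ par) , lift (proj₁ (proj₂ par)) , lift (proj₂ (proj₂ par)))
      where
      C′-spans-c : Spans C′ c
      C′-spans-c = trans (cong ρ C′∪c≡C) ρC≡ρC′
      lift : ∀ {Y} → ρ (C ∪ Y) ≡ suc (ρ C) → ρ (C′ ∪ Y) ≡ suc (ρ C′)
      lift {Y} ρ[C∪Y]≡ = begin
        ρ (C′ ∪ Y)              ≡⟨ spans-mono ∪⁺ˡ C′-spans-c ⟨
        ρ ((C′ ∪ Y) ∪ ⁅ c ⁆)    ≡⟨ ρ[C∪Y] Y ⟨
        ρ (C ∪ Y)               ≡⟨ ρ[C∪Y]≡ ⟩
        suc (ρ C)               ≡⟨ cong suc ρC≡ρC′ ⟩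
        suc (ρ C′)              ∎
        where open ≡-Reasoning

  private
    ρ[C′∪x]≡ρ[C] : ∀ x → ρ (C ∪ ⁅ x ⁆) ≡ suc (ρ C) → ρ (C′ ∪ ⁅ x ⁆) ≡ ρ C
    ρ[C′∪x]≡ρ[C] x ρ[C∪x]≡ =
      trans (m≤n≤1+m∧n≢m⇒n≡1+m (ρ-mono ∪⁺ˡ) (ρ-step C′ x) C′-misses-x) (sym ρ[C]≡1+ρ[C′])
      where
      C′-misses-x : ¬ Spans C′ x
      C′-misses-x spans = ℕ.1+n≢n (sym (trans (sym (spans-mono ∩⁻ˡ spans)) ρ[C∪x]≡))

  ρ[C′∪e]≡ρ[C] : ρ (C′ ∪ ⁅ e ⁆) ≡ ρ C
  ρ[C′∪e]≡ρ[C] = ρ[C′∪x]≡ρ[C] e (proj₁ par)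

  ρ[C′∪f]≡ρ[C] : ρ (C′ ∪ ⁅ f ⁆) ≡ ρ C
  ρ[C′∪f]≡ρ[C] = ρ[C′∪x]≡ρ[C] f (proj₁ (proj₂ par))

  ρ[C′∪ef]≡1+ρ[C] : ρ (C′ ∪ (⁅ e ⁆ ∪ ⁅ f ⁆)) ≡ suc (ρ C)
  ρ[C′∪ef]≡1+ρ[C] = m≤n≤1+m∧n≢m⇒n≡1+m
    (subst (_≤ ρ (C′ ∪ (⁅ e ⁆ ∪ ⁅ f ⁆))) ρ[C′∪e]≡ρ[C] (ρ-mono (∪-lub ∪⁺ˡ (∪⁺ʳ ∘′ ∪⁺ˡ))))
    (ℕ.≤-trans (ρ-mono (∪-lub (∪⁺ˡ ∘′ ∩⁻ˡ) ∪⁺ʳ)) (ℕ.≤-reflexive (proj₂ (proj₂ par))))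
    (λ ρ≡ρC → proj₂ minpar c c∈C (trans ρ[C′∪e]≡ρ[C] ρ[C]≡1+ρ[C′] , trans ρ[C′∪f]≡ρ[C] ρ[C]≡1+ρ[C′] ,
                                  trans ρ≡ρC ρ[C]≡1+ρ[C′]))

-- Contracting W and deleting everything outside W ∪ ψ[Fin k] leaves U_{1,k}.
module _ (M : Matroid n) {k : ℕ} (ψ : Fin k → Fin n) (ψ-injective : Injective _≡_ _≡_ ψ) {W : Subset n}
         (ψ-independent : ∀ i → rk M (W ∪ ⁅ ψ i ⁆) ≡ suc (rk M W))
         (ψ-rank-one : rk M (W ∪ image ψ ⊤) ≤ suc (rk M W)) where

  private
    D = ∁ (W ∪ image ψ ⊤)

    ψ∉W : ∀ i → ψ i ∉ W
    ψ∉W i ψi∈W = ℕ.1+n≰n (subst (_≤ rk M W) (ψ-independent i) (rk-mono M (∪-lub id (⁅⁆⊆ ψi∈W))))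

    ψ∉D : ∀ i → ψ i ∉ D
    ψ∉D i ψi∈D = ∁⁻ ψi∈D (∪⁺ʳ (∈-image⁺ ψ ⊤ i ∈⊤))

    outside-W∪D : ∀ x → (x ∉ W × x ∉ D) ⇔ (∃ λ i → ψ i ≡ x)
    outside-W∪D x = mk⇔ to from
      where
      to : x ∉ W × x ∉ D → ∃ λ i → ψ i ≡ x
      to (x∉W , x∉D) with ∪⁻ (x∉∁p⇒x∈p x∉D)
      ... | inj₁ x∈W = ⊥-elim (x∉W x∈W)
      ... | inj₂ x∈ψ with ∈-image⁻ ψ ⊤ x x∈ψ
      ...   | i , _ , ψi≡x = i , ψi≡x
      from : (∃ λ i → ψ i ≡ x) → x ∉ W × x ∉ D
      from (i , refl) = ψ∉W i , ψ∉D i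

    rank-one : ∀ X → U-rk 1 k X + rk M W ≡ rk M (image ψ X ∪ W)
    rank-one X with nonempty? X
    ... | yes (i , i∈X) = trans (cong (_+ rk M W) (ℕ.m≤n⇒m⊓n≡m (x∈p⇒1≤∣p∣ i∈X))) (ℕ.≤-antisym
          (subst (_≤ rk M (image ψ X ∪ W)) (ψ-independent i) (rk-mono M (∪-lub ∪⁺ʳ (∪⁺ˡ ∘′ ⁅⁆⊆ (∈-image⁺ ψ X i i∈X)))))
          (ℕ.≤-trans (rk-mono M (∪-lub (∪⁺ʳ ∘′ image-mono) ∪⁺ˡ)) ψ-rank-one))
      where
      image-mono : image ψ X ⊆ image ψ ⊤
      image-mono {x} x∈ with ∈-image⁻ ψ X x x∈
      ... | j , _ , refl = ∈-image⁺ ψ ⊤ j ∈⊤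
    ... | no X-empty = begin
      1 ⊓ ∣ X ∣ + rk M W     ≡⟨ cong (λ Y → 1 ⊓ ∣ Y ∣ + rk M W) (Empty-unique X-empty) ⟩
      1 ⊓ ∣ ⊥ {k} ∣ + rk M W ≡⟨ cong (λ m → 1 ⊓ m + rk M W) (∣⊥∣≡0 k) ⟩
      rk M W                 ≡⟨ cong (rk M) (⊆-antisym ∪⁺ʳ (∪-lub image-empty id)) ⟩
      rk M (image ψ X ∪ W)   ∎
      where
      open ≡-Reasoning
      image-empty : image ψ X ⊆ W
      image-empty {x} x∈ with ∈-image⁻ ψ X x x∈
      ... | j , j∈X , _ = ⊥-elim (X-empty (j , j∈X))

  rank-one-minor : ∀ i j → HasMinorUsing M k (U-rk 1 k) (ψ i) (ψ j)
  rank-one-minor i j = W , D , ψ , (λ _ x∈W x∈D → ∁⁻ x∈D (∪⁺ˡ x∈W)) , ψ-injective , outside-W∪D , rank-one ,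
                       (ψ∉W i , ψ∉D i) , (ψ∉W j , ψ∉D j)

-- Three-connected matroids

module ThreeConnectedProperties (M : Matroid n) (3-connected : ThreeConnected M) where

  rk-small-set : ∀ {X} j → j < 3 → ∣ X ∣ ≡ j → j ≤ ∣ ∁ X ∣ → rk M X ≡ j × rk M (∁ X) ≡ rank M
  rk-small-set {X} j j<3 ∣X∣≡j j≤∣∁X∣ =
    tight-sum (3-connected X j j<3 (ℕ.≤-reflexive (sym ∣X∣≡j)) j≤∣∁X∣)
              (subst (rk M X ≤_) ∣X∣≡j (rk-bound M X)) (rk-mono M ⊆⊤)

  rk-singleton : 2 ≤ n → ∀ x → rk M ⁅ x ⁆ ≡ 1 × rk M (∁ ⁅ x ⁆) ≡ rank M
  rk-singleton 2≤n x = rk-small-set 1 (s≤s (s≤s z≤n)) (∣⁅x⁆∣≡1 x)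
    (subst (1 ≤_) (trans (cong (n ∸_) (sym (∣⁅x⁆∣≡1 x))) (sym (∣∁p∣≡n∸∣p∣ ⁅ x ⁆))) (ℕ.m+n≤o⇒m≤o∸n 1 2≤n))

  rk-pair : 4 ≤ n → x ≢ y → rk M (⁅ x ⁆ ∪ ⁅ y ⁆) ≡ 2 × rk M (∁ (⁅ x ⁆ ∪ ⁅ y ⁆)) ≡ rank M
  rk-pair {x = x} {y = y} 4≤n x≢y = rk-small-set 2 (s≤s (s≤s (s≤s z≤n))) (∣⁅x⁆∪⁅y⁆∣≡2 x≢y)
    (subst (2 ≤_) (trans (cong (n ∸_) (sym (∣⁅x⁆∪⁅y⁆∣≡2 x≢y))) (sym (∣∁p∣≡n∸∣p∣ (⁅ x ⁆ ∪ ⁅ y ⁆)))) (ℕ.m+n≤o⇒m≤o∸n 2 4≤n))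

  rank+3≤n⇒4≤n : rank M + 3 ≤ n → 4 ≤ n
  rank+3≤n⇒4≤n r+3≤n = ℕ.≤-trans (ℕ.+-monoˡ-≤ 3 1≤rank) r+3≤n
    where
    2≤n : 2 ≤ n
    2≤n = ℕ.≤-trans (ℕ.n≤1+n 2) (ℕ.≤-trans (ℕ.m≤n+m 3 (rank M)) r+3≤n)
    1≤rank : 1 ≤ rank M
    1≤rank = subst (_≤ rank M) (proj₁ (rk-singleton 2≤n (fromℕ< (ℕ.≤-trans (s≤s z≤n) 2≤n))))
                   (rk-mono M ⊆⊤)

module Backward (M : Matroid n) (3-connected : ThreeConnected M) (rank+3≤n : rank M + 3 ≤ n)
                {e f : Fin n} (e≢f : e ≢ f) where
  open ThreeConnectedProperties M 3-connected
  open DualRank M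
  open RankLikeProperties (dualRank M)

  private
    R* = dualRank M
    r = rank M
    4≤n = rank+3≤n⇒4≤n rank+3≤n
    EF = ⁅ e ⁆ ∪ ⁅ f ⁆

  ρ*[x]≡1+r : ∀ x → ρ* ⁅ x ⁆ ≡ suc r
  ρ*[x]≡1+r x = cong₂ _+_ (∣⁅x⁆∣≡1 x) (proj₂ (rk-singleton (ℕ.≤-trans (ℕ.m≤n+m 2 2) 4≤n) x))

  ρ*[EF]≡2+r : ρ* EF ≡ 2 + r
  ρ*[EF]≡2+r = cong₂ _+_ (∣⁅x⁆∪⁅y⁆∣≡2 e≢f) (proj₂ (rk-pair 4≤n e≢f))

  cl* : Subset n
  cl* = tabulate (λ c → ⌊ ρ* (EF ∪ ⁅ c ⁆) ℕ.≟ ρ* EF ⌋)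

  T : Subset n
  T = EF ∪ ∁ cl*

  cl*-spanned : ∀ c → c ∈ cl* → Spans EF c
  cl*-spanned c = ∈-tabulate⁻ (λ c → ρ* (EF ∪ ⁅ c ⁆) ℕ.≟ ρ* EF)

  T-unspanned : ∀ {c} → c ∈ T → c ≢ e → c ≢ f → ¬ Spans EF c
  T-unspanned c∈T c≢e c≢f spans with ∪⁻ c∈T
  ... | inj₁ c∈EF = [ c≢e ∘′ ∈⁅⁆⇒≡ , c≢f ∘′ ∈⁅⁆⇒≡ ]′ (∪⁻ c∈EF)
  ... | inj₂ c∉cl* = ∁⁻ c∉cl* (∈-tabulate⁺ (λ c → ρ* (EF ∪ ⁅ c ⁆) ℕ.≟ ρ* EF) spans)

  EF⊆cl* : EF ⊆ cl*
  EF⊆cl* {x} x∈EF = ∈-tabulate⁺ (λ c → ρ* (EF ∪ ⁅ c ⁆) ℕ.≟ ρ* EF) (ρ-cong (∪-lub id (⁅⁆⊆ x∈EF)) ∪⁺ˡ)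

  ∁T⊆cl* : ∁ T ⊆ cl*
  ∁T⊆cl* c∈∁T = x∉∁p⇒x∈p (∁⁻ c∈∁T ∘′ ∪⁺ʳ)

  ρ*[cl*]≡2+r : ρ* cl* ≡ 2 + r
  ρ*[cl*]≡2+r = trans (ρ-cong (∪⁺ʳ {p = EF}) (∪-lub EF⊆cl* id)) (trans (spans-all cl*-spanned) ρ*[EF]≡2+r)

  2≤∣cl*∣ : 2 ≤ ∣ cl* ∣
  2≤∣cl*∣ = x,y∈p⇒2≤∣p∣ (EF⊆cl* (∪⁺ˡ (x∈⁅x⁆ e))) (EF⊆cl* (∪⁺ʳ (x∈⁅x⁆ f))) e≢f

  ∁cl*-spanning : n ≤ ρ* (∁ cl*)
  ∁cl*-spanning with 2 ≤? ∣ ∁ cl* ∣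
  ... | yes 2≤∣∁cl*∣ = ℕ.+-cancelˡ-≤ (2 + r) n _ (begin
    2 + r + n                       ≡⟨ trans (ℕ.+-comm (2 + r) n) (cong (n +_) (ℕ.+-comm 2 r)) ⟩
    n + (r + 2)                     ≤⟨ ℕ.+-monoʳ-≤ n (3-connected cl* 2 ℕ.≤-refl 2≤∣cl*∣ 2≤∣∁cl*∣) ⟩
    n + (rk M cl* + rk M (∁ cl*))   ≡⟨ ρ*+ρ*∁≡n+rk+rk∁ cl* ⟨
    ρ* cl* + ρ* (∁ cl*)             ≡⟨ cong (_+ ρ* (∁ cl*)) ρ*[cl*]≡2+r ⟩
    2 + r + ρ* (∁ cl*)              ∎)
    where open ℕ.≤-Reasoning
  ... | no 2≰∣∁cl*∣ = ⊥-elim (ℕ.<⇒≱ (ℕ.≤-trans (ℕ.≤-reflexive (ℕ.+-comm 3 r)) rank+3≤n) n≤2+r)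
    where
    open ℕ.≤-Reasoning
    j = ∣ ∁ cl* ∣
    j≤1 : j ≤ 1
    j≤1 = ℕ.≤-pred (ℕ.≰⇒> 2≰∣∁cl*∣)
    n≤2+r : n ≤ 2 + r
    n≤2+r = ℕ.+-cancelʳ-≤ (r + j) n (2 + r) (begin
      n + (r + j)                     ≤⟨ ℕ.+-monoʳ-≤ n (3-connected cl* j (s≤s (ℕ.≤-trans j≤1 (s≤s z≤n)))
                                                        (ℕ.≤-trans j≤1 (ℕ.≤-trans (s≤s z≤n) 2≤∣cl*∣)) ℕ.≤-refl) ⟩
      n + (rk M cl* + rk M (∁ cl*))   ≡⟨ ρ*+ρ*∁≡n+rk+rk∁ cl* ⟨
      ρ* cl* + (j + rk M (∁ (∁ cl*))) ≤⟨ ℕ.+-mono-≤ (ℕ.≤-reflexive ρ*[cl*]≡2+r) (ℕ.+-monoʳ-≤ j (rk-mono M ⊆⊤)) ⟩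
      (2 + r) + (j + r)               ≡⟨ cong ((2 + r) +_) (ℕ.+-comm j r) ⟩
      (2 + r) + (r + j)               ∎)

  ρ*[T]≡n : ρ* T ≡ n
  ρ*[T]≡n = ℕ.≤-antisym (ρ*≤n T) (ℕ.≤-trans ∁cl*-spanning (ρ-mono ∪⁺ʳ))

  ∁cl*⊆ : ∀ {P} → (∀ {x} → x ∈ T → x ≢ f → x ≢ e → x ∈ P) → ∁ cl* ⊆ P
  ∁cl*⊆ T∖ef⊆P x∈∁cl* = T∖ef⊆P (∪⁺ʳ x∈∁cl*) (λ { refl → ∁⁻ x∈∁cl* (EF⊆cl* (∪⁺ʳ (x∈⁅x⁆ f))) })
                                            (λ { refl → ∁⁻ x∈∁cl* (EF⊆cl* (∪⁺ˡ (x∈⁅x⁆ e))) })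

  module _ {A : Subset n} (separation : Separation R* T e f A) where
    private
      B = T ∩ ∁ A
      e∈A = proj₁ (proj₂ separation)
      f∉A = proj₁ (proj₂ (proj₂ separation))
      f∈B : f ∈ B
      f∈B = ∩⁺ (∪⁺ˡ (∪⁺ʳ (x∈⁅x⁆ f))) (∁⁺ f∉A)
      A⊆∁B : A ⊆ ∁ B
      A⊆∁B x∈A = ∁⁺ (λ x∈B → ∁⁻ (∩⁻ʳ x∈B) x∈A)

    ρ*[A]+ρ*[T∖A]≤n+r : ρ* A + ρ* B ≤ n + r
    ρ*[A]+ρ*[T∖A]≤n+r = ℕ.≤-trans (proj₂ (proj₂ (proj₂ separation))) (ℕ.≤-reflexive (cong₂ _+_ ρ*[T]≡n ρ*⊥≡rank))

    ρ*[∁[T∖A]]≤1+ρ*[A] : ρ* (∁ B) ≤ suc (ρ* A)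
    ρ*[∁[T∖A]]≤1+ρ*[A] = begin
      ρ* (∁ B)                     ≤⟨ ρ-mono ∁B⊆ ⟩
      ρ* ((A ∪ ⁅ f ⁆) ∪ ∁ T)       ≡⟨ spans-all (λ c c∈∁T → spans-mono EF⊆A∪f (cl*-spanned c (∁T⊆cl* c∈∁T))) ⟩
      ρ* (A ∪ ⁅ f ⁆)               ≤⟨ ρ-step A f ⟩
      suc (ρ* A)                   ∎
      where
      open ℕ.≤-Reasoning
      EF⊆A∪f : EF ⊆ A ∪ ⁅ f ⁆
      EF⊆A∪f = ∪-lub (∪⁺ˡ ∘′ ⁅⁆⊆ e∈A) ∪⁺ʳ
      ∁B⊆ : ∁ B ⊆ (A ∪ ⁅ f ⁆) ∪ ∁ T
      ∁B⊆ {x} x∈∁B with x ∈? T | x ∈? A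
      ... | no x∉T  | _       = ∪⁺ʳ (∁⁺ x∉T)
      ... | yes _   | yes x∈A = ∪⁺ˡ (∪⁺ˡ x∈A)
      ... | yes x∈T | no x∉A  = ⊥-elim (∁⁻ x∈∁B (∩⁺ x∈T (∁⁺ x∉A)))

    -- A side containing only e or only f would contain E − cl*, which is spanning in M*.
    2≤∣T∖A∣ : 2 ≤ ∣ B ∣
    2≤∣T∖A∣ with any? (λ b → (b ∈? B) ×-dec ¬? (b ≟ f))
    ... | yes (b , b∈B , b≢f) = x,y∈p⇒2≤∣p∣ b∈B f∈B b≢f
    ... | no B⊆f = ⊥-elim (ℕ.<⇒≱ (ℕ.≤-reflexive (sym (ℕ.+-suc n r))) (ℕ.≤-trans
          (ℕ.+-mono-≤ (ℕ.≤-trans ∁cl*-spanning (ρ-mono (∁cl*⊆ T∖ef⊆A)))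
                      (subst (_≤ ρ* B) (ρ*[x]≡1+r f) (ρ-mono (⁅⁆⊆ f∈B))))
          ρ*[A]+ρ*[T∖A]≤n+r))
      where
      T∖ef⊆A : ∀ {x} → x ∈ T → x ≢ f → x ≢ e → x ∈ A
      T∖ef⊆A {x} x∈T x≢f _ with x ∈? A
      ... | yes x∈A = x∈A
      ... | no x∉A  = ⊥-elim (B⊆f (x , ∩⁺ x∈T (∁⁺ x∉A) , x≢f))

    2≤∣∁[T∖A]∣ : 2 ≤ ∣ ∁ B ∣
    2≤∣∁[T∖A]∣ with any? (λ a → (a ∈? A) ×-dec ¬? (a ≟ e))
    ... | yes (a , a∈A , a≢e) = x,y∈p⇒2≤∣p∣ (A⊆∁B a∈A) (A⊆∁B e∈A) a≢e
    ... | no A⊆e = ⊥-elim (ℕ.<⇒≱ (ℕ.≤-reflexive (sym (ℕ.+-suc n r))) (ℕ.≤-trans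
          (ℕ.+-mono-≤ (ℕ.≤-trans ∁cl*-spanning (ρ-mono (∁cl*⊆ T∖ef⊆B)))
                      (subst (_≤ ρ* A) (ρ*[x]≡1+r e) (ρ-mono (⁅⁆⊆ e∈A))))
          (subst (_≤ n + r) (ℕ.+-comm (ρ* A) (ρ* B)) ρ*[A]+ρ*[T∖A]≤n+r)))
      where
      T∖ef⊆B : ∀ {x} → x ∈ T → x ≢ f → x ≢ e → x ∈ B
      T∖ef⊆B {x} x∈T _ x≢e with x ∈? A
      ... | yes x∈A = ⊥-elim (A⊆e (x , x∈A , x≢e))
      ... | no x∉A  = ∩⁺ x∈T (∁⁺ x∉A)

  -- T − A would be a 2-separating set of M.
  no-separation : ∀ A → ¬ Separation R* T e f A
  no-separation A sep = ℕ.<⇒≱ (ℕ.≤-reflexive (solve-n+r n r)) (begin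
    n + (r + 2)                  ≤⟨ ℕ.+-monoʳ-≤ n (3-connected B 2 ℕ.≤-refl (2≤∣T∖A∣ sep) (2≤∣∁[T∖A]∣ sep)) ⟩
    n + (rk M B + rk M (∁ B))    ≡⟨ ρ*+ρ*∁≡n+rk+rk∁ B ⟨
    ρ* B + ρ* (∁ B)              ≤⟨ ℕ.+-monoʳ-≤ (ρ* B) (ρ*[∁[T∖A]]≤1+ρ*[A] sep) ⟩
    ρ* B + suc (ρ* A)            ≡⟨ trans (ℕ.+-suc (ρ* B) _) (cong suc (ℕ.+-comm (ρ* B) _)) ⟩
    suc (ρ* A + ρ* B)            ≤⟨ s≤s (ρ*[A]+ρ*[T∖A]≤n+r sep) ⟩
    suc (n + r)                  ∎)
    where
    open ℕ.≤-Reasoning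
    B = T ∩ ∁ A
    solve-n+r : ∀ n r → suc (suc (n + r)) ≡ n + (r + 2)
    solve-n+r = solve-∀

  -- Contracting W = E − (C ∪ {e, f}) leaves a rank-one matroid without loops on C ∪ {e, f}.
  module FromMinimalParallel {C : Subset n} (C⊆T : C ⊆ T) (e∉C : e ∉ C) (f∉C : f ∉ C)
                             (minpar : MinimalParallel R* C e f) where
    private
      module Rk = RankLikeProperties (matroidRank M)
      par = proj₁ minpar
      Z = C ∪ EF
      W = ∁ Z
      w = rk M W
      ρ*[Z]≡1+ρ*[C] : ρ* Z ≡ suc (ρ* C)
      ρ*[Z]≡1+ρ*[C] = proj₂ (proj₂ par)
      c≢e : ∀ {c} → c ∈ C → c ≢ e
      c≢e c∈C refl = e∉C c∈C
      c≢f : ∀ {c} → c ∈ C → c ≢ f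
      c≢f c∈C refl = f∉C c∈C
      c∉C∖c : ∀ {c} → c ∉ C ∩ ∁ ⁅ c ⁆
      c∉C∖c {c} c∈ = ∁⁻ (∩⁻ʳ c∈) (x∈⁅x⁆ c)

    W+x-independent : ∀ {Y x} → x ∉ Y → Y ∪ ⁅ x ⁆ ≡ Z → ρ* Y ≡ ρ* Z → rk M (W ∪ ⁅ x ⁆) ≡ suc w
    W+x-independent {Y} {x} x∉Y Y∪x≡Z ρ*Y≡ρ*Z = rk[∁Z∪D]≡1+rk[∁Z] (∉⇒Disjoint x∉Y) Y∪x≡Z
      (trans (cong₂ _+_ ρ*Y≡ρ*Z (∣⁅x⁆∣≡1 x)) (ℕ.+-comm (ρ* Z) 1))

    W+xy-rank-one : ∀ {Y x y} → x ≢ y → x ∉ Y → y ∉ Y → Y ∪ (⁅ x ⁆ ∪ ⁅ y ⁆) ≡ Z → suc (ρ* Y) ≡ ρ* Z →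
                    rk M (W ∪ (⁅ x ⁆ ∪ ⁅ y ⁆)) ≡ suc w
    W+xy-rank-one {Y} x≢y x∉Y y∉Y Y∪xy≡Z 1+ρ*Y≡ρ*Z = rk[∁Z∪D]≡1+rk[∁Z] (∉⇒Disjoint₂ x∉Y y∉Y) Y∪xy≡Z
      (trans (cong₂ _+_ refl (∣⁅x⁆∪⁅y⁆∣≡2 x≢y)) (trans (ℕ.+-comm (ρ* Y) 2) (cong suc 1+ρ*Y≡ρ*Z)))

    C∪f∪e≡Z : (C ∪ ⁅ f ⁆) ∪ ⁅ e ⁆ ≡ Z
    C∪f∪e≡Z = trans (∪-swapʳ C ⁅ f ⁆ ⁅ e ⁆) (∪-assoc C ⁅ e ⁆ ⁅ f ⁆)

    W+e : rk M (W ∪ ⁅ e ⁆) ≡ suc w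
    W+e = W+x-independent (∉∪ e∉C (x≢y⇒x∉⁅y⁆ e≢f)) C∪f∪e≡Z
            (trans (proj₁ (proj₂ par)) (sym ρ*[Z]≡1+ρ*[C]))

    W+f : rk M (W ∪ ⁅ f ⁆) ≡ suc w
    W+f = W+x-independent (∉∪ f∉C (x≢y⇒x∉⁅y⁆ (e≢f ∘′ sym))) (∪-assoc C ⁅ e ⁆ ⁅ f ⁆)
            (trans (proj₁ par) (sym ρ*[Z]≡1+ρ*[C]))

    W+c : ∀ {c} → c ∈ C → rk M (W ∪ ⁅ c ⁆) ≡ suc w
    W+c {c} c∈C = W+x-independent (∉∪ c∉C∖c (∉∪ (x≢y⇒x∉⁅y⁆ (c≢e c∈C)) (x≢y⇒x∉⁅y⁆ (c≢f c∈C))))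
                    (trans (∪-swapʳ C′ EF ⁅ c ⁆) (cong (_∪ EF) C′∪c≡C))
                    (trans ρ[C′∪ef]≡1+ρ[C] (sym ρ*[Z]≡1+ρ*[C]))
      where open MinimalParallelProperties R* minpar c∈C

    W+fe : rk M (W ∪ (⁅ f ⁆ ∪ ⁅ e ⁆)) ≡ suc w
    W+fe = W+xy-rank-one (e≢f ∘′ sym) f∉C e∉C (cong (C ∪_) (∪-comm ⁅ f ⁆ ⁅ e ⁆)) (sym ρ*[Z]≡1+ρ*[C])

    W+ce : ∀ {c} → c ∈ C → rk M (W ∪ (⁅ c ⁆ ∪ ⁅ e ⁆)) ≡ suc w
    W+ce {c} c∈C = W+xy-rank-one (c≢e c∈C) (∉∪ c∉C∖c (x≢y⇒x∉⁅y⁆ (c≢f c∈C))) (∉∪ (e∉C ∘′ ∩⁻ˡ) (x≢y⇒x∉⁅y⁆ e≢f))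
                     C′∪f∪ce≡Z (trans (cong suc ρ[C′∪f]≡ρ[C]) (sym ρ*[Z]≡1+ρ*[C]))
      where
      open MinimalParallelProperties R* minpar c∈C
      open ≡-Reasoning
      C′∪f∪ce≡Z : (C′ ∪ ⁅ f ⁆) ∪ (⁅ c ⁆ ∪ ⁅ e ⁆) ≡ Z
      C′∪f∪ce≡Z = begin
        (C′ ∪ ⁅ f ⁆) ∪ (⁅ c ⁆ ∪ ⁅ e ⁆) ≡⟨ ∪-assoc (C′ ∪ ⁅ f ⁆) ⁅ c ⁆ ⁅ e ⁆ ⟨
        ((C′ ∪ ⁅ f ⁆) ∪ ⁅ c ⁆) ∪ ⁅ e ⁆ ≡⟨ cong (_∪ ⁅ e ⁆) (∪-swapʳ C′ ⁅ f ⁆ ⁅ c ⁆) ⟩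
        ((C′ ∪ ⁅ c ⁆) ∪ ⁅ f ⁆) ∪ ⁅ e ⁆ ≡⟨ cong (λ D → (D ∪ ⁅ f ⁆) ∪ ⁅ e ⁆) C′∪c≡C ⟩
        (C ∪ ⁅ f ⁆) ∪ ⁅ e ⁆            ≡⟨ C∪f∪e≡Z ⟩
        Z                              ∎

    -- C = ∅ would make e and f parallel in M*, and C = {c} would put c into cl*.
    two-elements : ∃ λ c₁ → ∃ λ c₂ → c₁ ∈ C × c₂ ∈ C × c₁ ≢ c₂
    two-elements with nonempty? C
    ... | no C-empty = ⊥-elim (ℕ.1+n≢n (begin
      suc (suc r)   ≡⟨ ρ*[EF]≡2+r ⟨
      ρ* EF         ≡⟨ ρ-cong ∪⁺ʳ (∪-lub (λ x∈C → ⊥-elim (C-empty (_ , x∈C))) id) ⟩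
      ρ* Z          ≡⟨ ρ*[Z]≡1+ρ*[C] ⟩
      suc (ρ* C)    ≡⟨ cong (λ D → suc (ρ* D)) (Empty-unique C-empty) ⟩
      suc (ρ* ⊥)    ≡⟨ cong suc ρ*⊥≡rank ⟩
      suc r         ∎))
      where open ≡-Reasoning
    ... | yes (c₁ , c₁∈C) with any? (λ c → (c ∈? C) ×-dec ¬? (c ≟ c₁))
    ...   | yes (c₂ , c₂∈C , c₂≢c₁) = c₁ , c₂ , c₁∈C , c₂∈C , c₂≢c₁ ∘′ sym
    ...   | no only-c₁ = ⊥-elim (T-unspanned (C⊆T c₁∈C) (c≢e c₁∈C) (c≢f c₁∈C) (begin
      ρ* (EF ∪ ⁅ c₁ ⁆)  ≡⟨ cong ρ* EF∪c₁≡Z ⟩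
      ρ* Z              ≡⟨ ρ*[Z]≡1+ρ*[C] ⟩
      suc (ρ* C)        ≡⟨ cong (λ D → suc (ρ* D)) C≡c₁ ⟩
      suc (ρ* ⁅ c₁ ⁆)   ≡⟨ cong suc (ρ*[x]≡1+r c₁) ⟩
      suc (suc r)       ≡⟨ ρ*[EF]≡2+r ⟨
      ρ* EF             ∎))
      where
      open ≡-Reasoning
      C≡c₁ : C ≡ ⁅ c₁ ⁆
      C≡c₁ = ⊆-antisym C⊆c₁ (⁅⁆⊆ c₁∈C)
        where
        C⊆c₁ : C ⊆ ⁅ c₁ ⁆
        C⊆c₁ {x} x∈C with x ≟ c₁
        ... | yes refl = x∈⁅x⁆ c₁
        ... | no x≢c₁  = ⊥-elim (only-c₁ (x , x∈C , x≢c₁))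
      EF∪c₁≡Z : EF ∪ ⁅ c₁ ⁆ ≡ Z
      EF∪c₁≡Z = trans (∪-comm EF ⁅ c₁ ⁆) (cong (_∪ EF) (sym C≡c₁))

    W+e-spans : ∀ {x} → rk M (W ∪ (⁅ x ⁆ ∪ ⁅ e ⁆)) ≡ suc w → Rk.Spans (W ∪ ⁅ e ⁆) x
    W+e-spans {x} rk≡ = trans (cong (rk M) (trans (∪-swapʳ W ⁅ e ⁆ ⁅ x ⁆) (∪-assoc W ⁅ x ⁆ ⁅ e ⁆)))
                              (trans rk≡ (sym W+e))

    minor : HasMinorUsing M 4 (U-rk 1 4) e f
    minor with two-elements
    ... | c₁ , c₂ , c₁∈C , c₂∈C , c₁≢c₂ =
      rank-one-minor M ψ (λ {i} {j} → lookup-injective distinct i j) independent rank-one zero (suc zero)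
      where
      ψ : Fin 4 → Fin n
      ψ = lookup (e ∷ f ∷ c₁ ∷ c₂ ∷ [])
      distinct : Unique (e ∷ f ∷ c₁ ∷ c₂ ∷ [])
      distinct = (e≢f ∷ c≢e c₁∈C ∘′ sym ∷ c≢e c₂∈C ∘′ sym ∷ [])
               ∷ (c≢f c₁∈C ∘′ sym ∷ c≢f c₂∈C ∘′ sym ∷ [])
               ∷ (c₁≢c₂ ∷ [])
               ∷ []
               ∷ []
      independent : ∀ i → rk M (W ∪ ⁅ ψ i ⁆) ≡ suc w
      independent zero                   = W+e
      independent (suc zero)             = W+f
      independent (suc (suc zero))       = W+c c₁∈C
      independent (suc (suc (suc zero))) = W+c c₂∈C
      W+e-spans-ψ : ∀ i → Rk.Spans (W ∪ ⁅ e ⁆) (ψ i)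
      W+e-spans-ψ zero                   = Rk.ρ-cong (∪-lub id ∪⁺ʳ) ∪⁺ˡ
      W+e-spans-ψ (suc zero)             = W+e-spans W+fe
      W+e-spans-ψ (suc (suc zero))       = W+e-spans (W+ce c₁∈C)
      W+e-spans-ψ (suc (suc (suc zero))) = W+e-spans (W+ce c₂∈C)
      rank-one : rk M (W ∪ image ψ ⊤) ≤ suc w
      rank-one = ℕ.≤-trans (rk-mono M (∪-lub (∪⁺ˡ ∘′ ∪⁺ˡ) ∪⁺ʳ)) (ℕ.≤-reflexive
        (trans (Rk.spans-all λ x x∈ψ → case ∈-image⁻ ψ ⊤ x x∈ψ of λ { (i , _ , refl) → W+e-spans-ψ i }) W+e))

  U₁,₄-minor : HasMinorUsing M 4 (U-rk 1 4) e f
  U₁,₄-minor with parallel-or-separation R* e≢f (∪⁺ˡ (∪⁺ˡ (x∈⁅x⁆ e))) (∪⁺ˡ (∪⁺ʳ (x∈⁅x⁆ f)))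
  ... | inj₂ (A , sep) = ⊥-elim (no-separation A sep)
  ... | inj₁ (C , C⊆T , e∉C , f∉C , par) with minimal-parallel R* par
  ...   | C′ , C′⊆C , minpar = FromMinimalParallel.minor (C⊆T ∘′ C′⊆C) (e∉C ∘′ C′⊆C) (f∉C ∘′ C′⊆C) minpar

rank+3≤n⇒U₁,₄-connected : (M : Matroid n) → ThreeConnected M → rank M + 3 ≤ n → NConnected M 4 (U-rk 1 4)
rank+3≤n⇒U₁,₄-connected M 3-connected rank+3≤n =
  ℕ.≤-trans (ℕ.m≤n+m 2 2) (ThreeConnectedProperties.rank+3≤n⇒4≤n M 3-connected rank+3≤n) ,
  λ e f e≢f → Backward.U₁,₄-minor M 3-connected rank+3≤n e≢f

U₁,ₖ-minor⇒rank+k≤n : ∀ {k} (M : Matroid n) {e f} → HasMinorUsing M (suc k) (U-rk 1 (suc k)) e f →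
                      rank M + k ≤ n
U₁,ₖ-minor⇒rank+k≤n {n} {k} M (C , D , ψ , C∩D=∅ , ψ-injective , outside-C∪D , rank-eq , _) = begin
  rank M + k                        ≤⟨ ℕ.+-monoˡ-≤ k rank≤ ⟩
  suc (∣ C ∣ + ∣ D ∣) + k           ≡⟨ ℕ.+-suc (∣ C ∣ + ∣ D ∣) k ⟨
  ∣ C ∣ + ∣ D ∣ + suc k             ≤⟨ ℕ.+-monoʳ-≤ (∣ C ∣ + ∣ D ∣) (injective⇒≤∣p∣ ψ-injective ψ∉C∪D) ⟩
  ∣ C ∣ + ∣ D ∣ + ∣ ∁ (C ∪ D) ∣     ≡⟨ cong (_+ ∣ ∁ (C ∪ D) ∣) (Disjoint⇒∣p∪q∣≡∣p∣+∣q∣ C D C∩D=∅) ⟨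
  ∣ C ∪ D ∣ + ∣ ∁ (C ∪ D) ∣         ≡⟨ ∣p∣+∣∁p∣≡n (C ∪ D) ⟩
  n                                 ∎
  where
  open ℕ.≤-Reasoning
  ψ∉C∪D : ∀ i → ψ i ∈ ∁ (C ∪ D)
  ψ∉C∪D i = let (ψi∉C , ψi∉D) = Equivalence.from (outside-C∪D (ψ i)) (i , refl) in ∁⁺ (∉∪ ψi∉C ψi∉D)
  covered : ⊤ ⊆ (image ψ ⊤ ∪ C) ∪ D
  covered {x} _ with x ∈? C | x ∈? D
  ... | yes x∈C | _       = ∪⁺ˡ (∪⁺ʳ x∈C)
  ... | no _    | yes x∈D = ∪⁺ʳ x∈D
  ... | no x∉C  | no x∉D with Equivalence.to (outside-C∪D x) (x∉C , x∉D)
  ...   | i , refl = ∪⁺ˡ (∪⁺ˡ (∈-image⁺ ψ ⊤ i ∈⊤))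
  rank≤ : rank M ≤ suc (∣ C ∣ + ∣ D ∣)
  rank≤ = begin
    rank M                            ≤⟨ rk-mono M covered ⟩
    rk M ((image ψ ⊤ ∪ C) ∪ D)        ≤⟨ rk≤rk+∣∣ M (image ψ ⊤ ∪ C) D ⟩
    rk M (image ψ ⊤ ∪ C) + ∣ D ∣      ≡⟨ cong (_+ ∣ D ∣) (rank-eq ⊤) ⟨
    1 ⊓ ∣ ⊤ {suc k} ∣ + rk M C + ∣ D ∣ ≡⟨ cong (λ m → 1 ⊓ m + rk M C + ∣ D ∣) (∣⊤∣≡n (suc k)) ⟩
    suc (rk M C + ∣ D ∣)              ≤⟨ s≤s (ℕ.+-monoˡ-≤ ∣ D ∣ (rk-bound M C)) ⟩
    suc (∣ C ∣ + ∣ D ∣)               ∎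

rank-two⇒uniform : (M : Matroid n) → ThreeConnected M → 4 ≤ n → rank M ≡ 2 → M ≅ U-rk 2 n
rank-two⇒uniform {n} M 3-connected 4≤n rank≡2 =
  id , ((λ eq → eq) , λ y → y , λ eq → eq) , λ X → trans (rk≡2⊓∣∣ X) (cong (λ Y → 2 ⊓ ∣ Y ∣) (sym (image-id X)))
  where
  open ThreeConnectedProperties M 3-connected
  rk≡2⊓∣∣ : ∀ X → rk M X ≡ 2 ⊓ ∣ X ∣
  rk≡2⊓∣∣ X with nonempty? X
  ... | no X-empty = trans (ℕ.n≤0⇒n≡0 (ℕ.≤-trans (rk-bound M X) (ℕ.≤-reflexive ∣X∣≡0))) (cong (2 ⊓_) (sym ∣X∣≡0))
    where
    ∣X∣≡0 : ∣ X ∣ ≡ 0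
    ∣X∣≡0 = trans (cong ∣_∣ (Empty-unique X-empty)) (∣⊥∣≡0 n)
  ... | yes (x , x∈X) with any? (λ y → (y ∈? X) ×-dec ¬? (y ≟ x))
  ...   | yes (y , y∈X , y≢x) = trans
    (ℕ.≤-antisym (ℕ.≤-trans (rk-mono M ⊆⊤) (ℕ.≤-reflexive rank≡2))
                 (subst (_≤ rk M X) (proj₁ (rk-pair 4≤n y≢x)) (rk-mono M (∪-lub (⁅⁆⊆ y∈X) (⁅⁆⊆ x∈X)))))
    (sym (ℕ.m≤n⇒m⊓n≡m (x,y∈p⇒2≤∣p∣ y∈X x∈X y≢x)))
  ...   | no only-x = begin
    rk M X           ≡⟨ cong (rk M) X≡x ⟩
    rk M ⁅ x ⁆       ≡⟨ proj₁ (rk-singleton (ℕ.≤-trans (ℕ.m≤n+m 2 2) 4≤n) x) ⟩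
    2 ⊓ 1            ≡⟨ cong (2 ⊓_) (∣⁅x⁆∣≡1 x) ⟨
    2 ⊓ ∣ ⁅ x ⁆ ∣    ≡⟨ cong (λ Y → 2 ⊓ ∣ Y ∣) X≡x ⟨
    2 ⊓ ∣ X ∣        ∎
    where
    open ≡-Reasoning
    X≡x : X ≡ ⁅ x ⁆
    X≡x = ⊆-antisym X⊆x (⁅⁆⊆ x∈X)
      where
      X⊆x : X ⊆ ⁅ x ⁆
      X⊆x {y} y∈X with y ≟ x
      ... | yes refl = x∈⁅x⁆ x
      ... | no y≢x   = ⊥-elim (only-x (y , y∈X , y≢x))

uniform-or-large⇒rank+3≤n : (M : Matroid n) → (Σ ℕ λ m → 5 ≤ m × (M ≅ U-rk 2 m)) ⊎ (3 ≤ rank M × 3 ≤ corank M) →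
                            rank M + 3 ≤ n
uniform-or-large⇒rank+3≤n {n} M (inj₂ (_ , 3≤corank)) =
  subst (_≤ n) (ℕ.+-comm 3 (rank M)) (ℕ.m≤o∸n⇒m+n≤o 3 (subst (rank M ≤_) (∣⊤∣≡n n) (rk-bound M ⊤)) 3≤corank)
uniform-or-large⇒rank+3≤n {n} M (inj₁ (m , 5≤m , φ , (_ , φ-surjective) , rk≡)) =
  ℕ.≤-trans (ℕ.+-monoˡ-≤ 3 rank≤2) (ℕ.≤-trans 5≤m (injective⇒≤ φ⁻¹-injective))
  where
  rank≤2 : rank M ≤ 2
  rank≤2 = ℕ.≤-trans (ℕ.≤-reflexive (rk≡ ⊤)) (ℕ.m⊓n≤m 2 _)
  φ⁻¹ : Fin m → Fin n
  φ⁻¹ y = proj₁ (φ-surjective y)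
  φ∘φ⁻¹ : ∀ y → φ (φ⁻¹ y) ≡ y
  φ∘φ⁻¹ y = proj₂ (φ-surjective y) refl
  φ⁻¹-injective : Injective _≡_ _≡_ φ⁻¹
  φ⁻¹-injective {y} {y′} eq = trans (sym (φ∘φ⁻¹ y)) (trans (cong φ eq) (φ∘φ⁻¹ y′))

U₁,₄-connected⇒uniform-or-large : (M : Matroid n) → ThreeConnected M → NConnected M 4 (U-rk 1 4) →
                                  (Σ ℕ λ m → 5 ≤ m × (M ≅ U-rk 2 m)) ⊎ (3 ≤ rank M × 3 ≤ corank M)
U₁,₄-connected⇒uniform-or-large {zero}        M _ (() , _)
U₁,₄-connected⇒uniform-or-large {suc zero}    M _ (s≤s () , _)
U₁,₄-connected⇒uniform-or-large {n@(suc (suc _))} M 3-connected (_ , connected) = classify (3 ≤? rank M)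
  where
  open ThreeConnectedProperties M 3-connected
  rank+3≤n = U₁,ₖ-minor⇒rank+k≤n M (connected zero (suc zero) (λ ()))
  4≤n = rank+3≤n⇒4≤n rank+3≤n
  2≤rank : 2 ≤ rank M
  2≤rank = subst (_≤ rank M) (proj₁ (rk-pair {x = zero} {y = suc zero} 4≤n (λ ()))) (rk-mono M ⊆⊤)
  classify : Dec (3 ≤ rank M) → (Σ ℕ λ m → 5 ≤ m × (M ≅ U-rk 2 m)) ⊎ (3 ≤ rank M × 3 ≤ corank M)
  classify (yes 3≤rank) = inj₂ (3≤rank , ℕ.m+n≤o⇒m≤o∸n 3 (subst (_≤ n) (ℕ.+-comm (rank M) 3) rank+3≤n))
  classify (no 3≰rank)  = inj₁ (_ , ℕ.≤-trans (ℕ.+-monoˡ-≤ 3 2≤rank) rank+3≤n ,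
                                rank-two⇒uniform M 3-connected 4≤n (ℕ.≤-antisym (ℕ.≤-pred (ℕ.≰⇒> 3≰rank)) 2≤rank))

proposition4p4 : ∀ {n} (M : Matroid n) → ThreeConnected M →
    (NConnected M 4 (U-rk 1 4) ⇔ ((Σ ℕ λ m → 5 ≤ m × (M ≅ U-rk 2 m)) ⊎ (3 ≤ rank M × 3 ≤ corank M)))
proposition4p4 M 3-connected = mk⇔
  (U₁,₄-connected⇒uniform-or-large M 3-connected)
  (rank+3≤n⇒U₁,₄-connected M 3-connected ∘′ uniform-or-large⇒rank+3≤n M)
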